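{- Let $\mathfrak{F}$ be a free filter on $\mathbb{N}$, and let $\mathcal{T}_1$ and $\mathcal{T}_2$ be decidable theories such that $\mathcal{T}_1$ is $\mathfrak{F}$-quasi-gentle and $\mathcal{T}_2$ is co-$\mathfrak{F}$-quasi-gentle. Then $\mathcal{T}_1\sqcup\mathcal{T}_2$ is decidable.
   Context: All logic is one-sorted first-order logic with equality, and all signatures are countable. A $\Sigma$-theory is a set of $\Sigma$-sentences; a $\mathcal{T}$-interpretation is a $\Sigma$-structure (nonempty domain) with a variable assignment satisfying all axioms of $\mathcal{T}$. $\mathcal{T}$ is decidable if there is an algorithm deciding, for a quantifier-free $\Sigma$-formula, whether some $\mathcal{T}$-interpretation satisfies it. The disjoint combination $\mathcal{T}_1\sqcup\mathcal{T}_2$ is the theory over the disjoint union of the signatures (renamed to share only equality) axiomatized by the union of the axioms. Let $\mathbb{N}^*=\{1,2,\dots\}$, $\mathbb{N}_\omega=\mathbb{N}\cup\{\aleph_0\}$. For quantifier-free $\varphi$, $\mathrm{Spec}_{\mathcal{T}}(\varphi)$ is the set of $n\in\mathbb{N}_\omega$ such that some $\mathcal{T}$-interpretation with domain of cardinality $n$ satisfies $\varphi$. $\mathcal{T}$ has computable finite spectra if there is an algorithm that, given quantifier-free $\varphi$ and $n\in\mathbb{N}^*$, decides whether $n\in\mathrm{Spec}_{\mathcal{T}}(\varphi)$. A filter on $\mathbb{N}$ is a set $\mathfrak{F}\subseteq\mathcal{P}(\mathbb{N})$ with $\emptyset\notin\mathfrak{F}$, $\mathbb{N}\in\mathfrak{F}$,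 closed under finite intersections and supersets; it is free if the intersection of all its members is empty (equivalently, it contains all cofinite sets). A decidable theory is $\mathfrak{F}$-quasi-gentle if it has computable finite spectra and the spectrum of every quantifier-free formula is either a finite subset of $\mathbb{N}^*$ or of the form $A\cup\{\aleph_0\}$ with $A\in\mathfrak{F}$. A decidable theory is co-$\mathfrak{F}$-quasi-gentle if it has computable finite spectra and the spectrum of every quantifier-free formula is either a finite subset of $\mathbb{N}^*$ or of the form $A\cup\{\aleph_0\}$ with $A\subseteq\mathbb{N}$ and $\mathbb{N}\setminus A\notin\mathfrak{F}$. -}

module Defs where

open import Level using (Level; Lift; lift) renaming (suc to lsuc; zero to lzero)
open import Data.Nat using (ℕ; _≤_)
open import Data.Fin using (Fin)
open import Data.Bool using (Bool; true)
open import Data.Maybe using (Maybe; just; nothing)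
open import Data.List using (List)
open import Data.List.Membership.Propositional using (_∈_)
open import Data.Vec using (Vec; []; _∷_)
open import Data.Product using (Σ; ∃; _×_; _,_)
open import Data.Sum using (_⊎_; inj₁; inj₂)
open import Data.Empty using (⊥)
open import Data.Unit using (⊤)
open import Relation.Nullary using (¬_; Dec; yes; no)
open import Relation.Binary.PropositionalEquality using (_≡_; _≢_)
open import Function.Bundles using (_↔_; _⇔_)
open import Function.Definitions using (Injective)
open import Data.Nat using (_≟_)

-- The paper works in classical set theory;
-- we make excluded middle (for Set₁-level statements, where all the
-- semantic notions below live) available wherever classical semantic
-- facts are asserted, but NEVER where an algorithm is constructed.

Classical : Set₂
Classical = (A : Set₁) → Dec A

-- A (possibly non-terminating) algorithm with inputs in A
-- and Boolean output is an Agda function  A → ℕ → Maybe Bool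
-- ("run with fuel k": nothing = not yet halted).

Algorithm : Set → Set
Algorithm A = A → ℕ → Maybe Bool

Decides : {A : Set} → Algorithm A → (A → Set₁) → Set₁
Decides {A} alg P =
  (a : A) → (∃ λ k → alg a k ≢ nothing)
          × ((k : ℕ) (b : Bool) → alg a k ≡ just b → (b ≡ true ⇔ P a))

-- Countable one-sorted first-order signatures (constants = 0-ary
-- function symbols).  Countability: injective codings into ℕ.

record Signature : Set₁ where
  field
    FunSym   : Set
    PredSym  : Set
    funAr    : FunSym → ℕ
    predAr   : PredSym → ℕ
    encF     : FunSym → ℕ
    encF-inj : Injective _≡_ _≡_ encF
    encP     : PredSym → ℕ
    encP-inj : Injective _≡_ _≡_ encP

open Signature public

Var : Set
Var = ℕ

data Term (Σ' : Signature) : Set where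
  var : Var → Term Σ'
  app : (f : FunSym Σ') → Vec (Term Σ') (funAr Σ' f) → Term Σ'

data Formula (Σ' : Signature) : Set where
  _≐_  : Term Σ' → Term Σ' → Formula Σ'
  rel  : (p : PredSym Σ') → Vec (Term Σ') (predAr Σ' p) → Formula Σ'
  ¬'_  : Formula Σ' → Formula Σ'
  _∧'_ : Formula Σ' → Formula Σ' → Formula Σ'
  _∨'_ : Formula Σ' → Formula Σ' → Formula Σ'
  _⇒'_ : Formula Σ' → Formula Σ' → Formula Σ'
  ∀'   : Var → Formula Σ' → Formula Σ'
  ∃'   : Var → Formula Σ' → Formula Σ'

data IsQF {Σ' : Signature} : Formula Σ' → Set where
  qf-≐ : ∀ {s t} → IsQF (s ≐ t)
  qf-rel : ∀ {p ts} → IsQF (rel p ts)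
  qf-¬ : ∀ {φ} → IsQF φ → IsQF (¬' φ)
  qf-∧ : ∀ {φ ψ} → IsQF φ → IsQF ψ → IsQF (φ ∧' ψ)
  qf-∨ : ∀ {φ ψ} → IsQF φ → IsQF ψ → IsQF (φ ∨' ψ)
  qf-⇒ : ∀ {φ ψ} → IsQF φ → IsQF ψ → IsQF (φ ⇒' ψ)

QF : Signature → Set
QF Σ' = Σ (Formula Σ') IsQF

mutual
  OccT : {Σ' : Signature} → Var → Term Σ' → Set
  OccT x (var y) = x ≡ y
  OccT x (app f ts) = OccV x ts

  OccV : {Σ' : Signature} {n : ℕ} → Var → Vec (Term Σ') n → Set
  OccV x [] = ⊥
  OccV x (t ∷ ts) = OccT x t ⊎ OccV x ts

FreeIn : {Σ' : Signature} → Var → Formula Σ' → Set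
FreeIn x (s ≐ t) = OccT x s ⊎ OccT x t
FreeIn x (rel p ts) = OccV x ts
FreeIn x (¬' φ) = FreeIn x φ
FreeIn x (φ ∧' ψ) = FreeIn x φ ⊎ FreeIn x ψ
FreeIn x (φ ∨' ψ) = FreeIn x φ ⊎ FreeIn x ψ
FreeIn x (φ ⇒' ψ) = FreeIn x φ ⊎ FreeIn x ψ
FreeIn x (∀' y φ) = x ≢ y × FreeIn x φ
FreeIn x (∃' y φ) = x ≢ y × FreeIn x φ

IsSentence : {Σ' : Signature} → Formula Σ' → Set
IsSentence φ = (x : Var) → ¬ FreeIn x φ

record Theory (Σ' : Signature) : Set₁ where
  field
    Ax       : Formula Σ' → Set
    Ax-sent  : (φ : Formula Σ') → Ax φ → IsSentence φ

open Theory public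

record Structure (Σ' : Signature) : Set₁ where
  field
    Dom    : Set
    inhab  : Dom
    funI   : (f : FunSym Σ') → Vec Dom (funAr Σ' f) → Dom
    predI  : (p : PredSym Σ') → Vec Dom (predAr Σ' p) → Set

open Structure public

module _ {Σ' : Signature} (M : Structure Σ') where
  mutual
    evalT : (Var → Dom M) → Term Σ' → Dom M
    evalT ρ (var x) = ρ x
    evalT ρ (app f ts) = funI M f (evalV ρ ts)

    evalV : {n : ℕ} → (Var → Dom M) → Vec (Term Σ') n → Vec (Dom M) n
    evalV ρ [] = []
    evalV ρ (t ∷ ts) = evalT ρ t ∷ evalV ρ ts

  update : (Var → Dom M) → Var → Dom M → (Var → Dom M)
  update ρ x d y with y ≟ x
  ... | yes _ = d
  ... | no _ = ρ y

  Sat : (Var → Dom M) → Formula Σ' → Set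
  Sat ρ (s ≐ t) = evalT ρ s ≡ evalT ρ t
  Sat ρ (rel p ts) = predI M p (evalV ρ ts)
  Sat ρ (¬' φ) = ¬ Sat ρ φ
  Sat ρ (φ ∧' ψ) = Sat ρ φ × Sat ρ ψ
  Sat ρ (φ ∨' ψ) = Sat ρ φ ⊎ Sat ρ ψ
  Sat ρ (φ ⇒' ψ) = Sat ρ φ → Sat ρ ψ
  Sat ρ (∀' x φ) = (d : Dom M) → Sat (update ρ x d) φ
  Sat ρ (∃' x φ) = Σ (Dom M) λ d → Sat (update ρ x d) φ

SatIn : {Σ' : Signature} → Theory Σ' → (Set → Set) → Formula Σ' → Set₁
SatIn {Σ'} T C φ =
  Σ (Structure Σ') λ M → Σ (Var → Dom M) λ ρ →
    C (Dom M) × ((ψ : Formula Σ') → Ax T ψ → Sat M ρ ψ) × Sat M ρ φ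

Satisfiable : {Σ' : Signature} → Theory Σ' → QF Σ' → Set₁
Satisfiable T (φ , _) = SatIn T (λ _ → ⊤) φ

data ℕω : Set where
  fin : ℕ → ℕω
  ℵ₀  : ℕω

HasCard : ℕω → Set → Set
HasCard (fin n) D = D ↔ Fin n
HasCard ℵ₀ D = D ↔ ℕ

InSpec : {Σ' : Signature} → Theory Σ' → QF Σ' → ℕω → Set₁
InSpec T (φ , _) c = SatIn T (HasCard c) φ

DecidableTheory : {Σ' : Signature} → Theory Σ' → Set₂
DecidableTheory {Σ'} T =
  Σ (Algorithm (QF Σ')) λ alg → Classical → Decides alg (Satisfiable T)

ℕ* : Set
ℕ* = Σ ℕ λ n → 1 ≤ n

ComputableFiniteSpectra : {Σ' : Signature} → Theory Σ' → Set₂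
ComputableFiniteSpectra {Σ'} T =
  Σ (Algorithm (QF Σ' × ℕ*)) λ alg →
    Classical → Decides alg (λ { (φ , (n , _)) → InSpec T φ (fin n) })

SubsetN : Set₂
SubsetN = ℕ → Set₁

_⊆N_ : SubsetN → SubsetN → Set₁
A ⊆N B = (n : ℕ) → A n → B n

record Filter : Set₃ where
  field
    member     : SubsetN → Set₁
    no-empty   : ¬ member (λ _ → Lift _ ⊥)
    has-all    : member (λ _ → Lift _ ⊤)
    closed-∩   : (A B : SubsetN) → member A → member B → member (λ n → A n × B n)
    closed-⊇   : (A B : SubsetN) → A ⊆N B → member A → member B

open Filter public

IsFree : Filter → Set₂
IsFree 𝔉 = (n : ℕ) → Σ SubsetN λ A → member 𝔉 A × ¬ A n

FiniteSpec : {Σ' : Signature} → Theory Σ' → QF Σ' → Set₁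
FiniteSpec T φ =
  Σ (List ℕ) λ L → ((c : ℕω) → InSpec T φ c ⇔ (Σ ℕ λ n → c ≡ fin n × n ∈ L))
                 × ((n : ℕ) → n ∈ L → 1 ≤ n)

FinPart : {Σ' : Signature} → Theory Σ' → QF Σ' → SubsetN
FinPart T φ n = InSpec T φ (fin n)

QuasiGentle : Filter → {Σ' : Signature} → Theory Σ' → Set₂
QuasiGentle 𝔉 {Σ'} T =
  DecidableTheory T × ComputableFiniteSpectra T ×
  (Classical → (φ : QF Σ') →
     FiniteSpec T φ ⊎ (InSpec T φ ℵ₀ × member 𝔉 (FinPart T φ)))

CoQuasiGentle : Filter → {Σ' : Signature} → Theory Σ' → Set₂
CoQuasiGentle 𝔉 {Σ'} T =
  DecidableTheory T × ComputableFiniteSpectra T ×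
  (Classical → (φ : QF Σ') →
     FiniteSpec T φ ⊎ (InSpec T φ ℵ₀ × ¬ member 𝔉 (λ n → ¬ FinPart T φ n)))


module _ where
  open import Data.Nat using (_*_; _+_; suc; zero)
  open import Data.Nat.Properties using (*-cancelˡ-≡; m≢1+m+n)
  open import Data.Nat.Properties using (+-suc)
  open import Relation.Binary.PropositionalEquality using (cong; sym; trans)
  open import Data.Empty using (⊥-elim)

  private
    open import Data.Nat.Solver using (module +-*-Solver)
    open +-*-Solver
    norm2 : (a : ℕ) → 2 * suc a ≡ 2 + 2 * a
    norm2 = solve 1 (λ a → con 2 :* (con 1 :+ a) := con 2 :+ con 2 :* a) Relation.Binary.PropositionalEquality.refl
    norm1 : (b : ℕ) → 1 + 2 * suc b ≡ 2 + (1 + 2 * b)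
    norm1 = solve 1 (λ b → con 1 :+ con 2 :* (con 1 :+ b) := con 2 :+ (con 1 :+ con 2 :* b)) Relation.Binary.PropositionalEquality.refl
    even≢odd : (a b : ℕ) → 2 * a ≢ 1 + 2 * b
    even≢odd zero b ()
    even≢odd (suc a) zero eq with trans (sym (norm2 a)) eq
    ... | ()
    even≢odd (suc a) (suc b) eq =
      even≢odd a b (Data.Nat.Properties.suc-injective (Data.Nat.Properties.suc-injective
        (trans (sym (norm2 a)) (trans eq (norm1 b)))))

  enc⊎ : {A B : Set} (e₁ : A → ℕ) (e₂ : B → ℕ) → A ⊎ B → ℕ
  enc⊎ e₁ e₂ (inj₁ a) = 2 * e₁ a
  enc⊎ e₁ e₂ (inj₂ b) = 1 + 2 * e₂ b

  encInj : {A B : Set} (e₁ : A → ℕ) (e₂ : B → ℕ) →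
           Injective _≡_ _≡_ e₁ → Injective _≡_ _≡_ e₂ →
           Injective _≡_ _≡_ (enc⊎ e₁ e₂)
  encInj e₁ e₂ i₁ i₂ {inj₁ a} {inj₁ a'} eq = cong inj₁ (i₁ (*-cancelˡ-≡ (e₁ a) (e₁ a') 2 eq))
  encInj e₁ e₂ i₁ i₂ {inj₁ a} {inj₂ b} eq = ⊥-elim (even≢odd (e₁ a) (e₂ b) eq)
  encInj e₁ e₂ i₁ i₂ {inj₂ b} {inj₁ a} eq = ⊥-elim (even≢odd (e₁ a) (e₂ b) (sym eq))
  encInj e₁ e₂ i₁ i₂ {inj₂ b} {inj₂ b'} eq =
    cong inj₂ (i₂ (*-cancelˡ-≡ (e₂ b) (e₂ b') 2 (Data.Nat.Properties.suc-injective eq)))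

  _⊕_ : Signature → Signature → Signature
  Σ₁ ⊕ Σ₂ = record
    { FunSym = FunSym Σ₁ ⊎ FunSym Σ₂
    ; PredSym = PredSym Σ₁ ⊎ PredSym Σ₂
    ; funAr = λ { (inj₁ f) → funAr Σ₁ f ; (inj₂ f) → funAr Σ₂ f }
    ; predAr = λ { (inj₁ p) → predAr Σ₁ p ; (inj₂ p) → predAr Σ₂ p }
    ; encF = enc⊎ (encF Σ₁) (encF Σ₂)
    ; encF-inj = encInj (encF Σ₁) (encF Σ₂) (encF-inj Σ₁) (encF-inj Σ₂)
    ; encP = enc⊎ (encP Σ₁) (encP Σ₂)
    ; encP-inj = encInj (encP Σ₁) (encP Σ₂) (encP-inj Σ₁) (encP-inj Σ₂)
    }

module _ {Σ₁ Σ₂ : Signature} where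
  mutual
    inlT : Term Σ₁ → Term (Σ₁ ⊕ Σ₂)
    inlT (var x) = var x
    inlT (app f ts) = app (inj₁ f) (inlV ts)

    inlV : {n : ℕ} → Vec (Term Σ₁) n → Vec (Term (Σ₁ ⊕ Σ₂)) n
    inlV [] = []
    inlV (t ∷ ts) = inlT t ∷ inlV ts

  mutual
    inrT : Term Σ₂ → Term (Σ₁ ⊕ Σ₂)
    inrT (var x) = var x
    inrT (app f ts) = app (inj₂ f) (inrV ts)

    inrV : {n : ℕ} → Vec (Term Σ₂) n → Vec (Term (Σ₁ ⊕ Σ₂)) n
    inrV [] = []
    inrV (t ∷ ts) = inrT t ∷ inrV ts

  inlF : Formula Σ₁ → Formula (Σ₁ ⊕ Σ₂)
  inlF (s ≐ t) = inlT s ≐ inlT t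
  inlF (rel p ts) = rel (inj₁ p) (inlV ts)
  inlF (¬' φ) = ¬' inlF φ
  inlF (φ ∧' ψ) = inlF φ ∧' inlF ψ
  inlF (φ ∨' ψ) = inlF φ ∨' inlF ψ
  inlF (φ ⇒' ψ) = inlF φ ⇒' inlF ψ
  inlF (∀' x φ) = ∀' x (inlF φ)
  inlF (∃' x φ) = ∃' x (inlF φ)

  inrF : Formula Σ₂ → Formula (Σ₁ ⊕ Σ₂)
  inrF (s ≐ t) = inrT s ≐ inrT t
  inrF (rel p ts) = rel (inj₂ p) (inrV ts)
  inrF (¬' φ) = ¬' inrF φ
  inrF (φ ∧' ψ) = inrF φ ∧' inrF ψ
  inrF (φ ∨' ψ) = inrF φ ∨' inrF ψ
  inrF (φ ⇒' ψ) = inrF φ ⇒' inrF ψ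
  inrF (∀' x φ) = ∀' x (inrF φ)
  inrF (∃' x φ) = ∃' x (inrF φ)

  private
    mutual
      occ-inlT : (x : Var) (t : Term Σ₁) → OccT x (inlT t) → OccT x t
      occ-inlT x (var y) o = o
      occ-inlT x (app f ts) o = occ-inlV x ts o

      occ-inlV : {n : ℕ} (x : Var) (ts : Vec (Term Σ₁) n) → OccV x (inlV ts) → OccV x ts
      occ-inlV x (t ∷ ts) (inj₁ o) = inj₁ (occ-inlT x t o)
      occ-inlV x (t ∷ ts) (inj₂ o) = inj₂ (occ-inlV x ts o)

    mutual
      occ-inrT : (x : Var) (t : Term Σ₂) → OccT x (inrT t) → OccT x t
      occ-inrT x (var y) o = o
      occ-inrT x (app f ts) o = occ-inrV x ts o

      occ-inrV : {n : ℕ} (x : Var) (ts : Vec (Term Σ₂) n) → OccV x (inrV ts) → OccV x ts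
      occ-inrV x (t ∷ ts) (inj₁ o) = inj₁ (occ-inrT x t o)
      occ-inrV x (t ∷ ts) (inj₂ o) = inj₂ (occ-inrV x ts o)

    free-inlF : (x : Var) (φ : Formula Σ₁) → FreeIn x (inlF φ) → FreeIn x φ
    free-inlF x (s ≐ t) (inj₁ o) = inj₁ (occ-inlT x s o)
    free-inlF x (s ≐ t) (inj₂ o) = inj₂ (occ-inlT x t o)
    free-inlF x (rel p ts) o = occ-inlV x ts o
    free-inlF x (¬' φ) o = free-inlF x φ o
    free-inlF x (φ ∧' ψ) (inj₁ o) = inj₁ (free-inlF x φ o)
    free-inlF x (φ ∧' ψ) (inj₂ o) = inj₂ (free-inlF x ψ o)
    free-inlF x (φ ∨' ψ) (inj₁ o) = inj₁ (free-inlF x φ o)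
    free-inlF x (φ ∨' ψ) (inj₂ o) = inj₂ (free-inlF x ψ o)
    free-inlF x (φ ⇒' ψ) (inj₁ o) = inj₁ (free-inlF x φ o)
    free-inlF x (φ ⇒' ψ) (inj₂ o) = inj₂ (free-inlF x ψ o)
    free-inlF x (∀' y φ) (ne , o) = ne , free-inlF x φ o
    free-inlF x (∃' y φ) (ne , o) = ne , free-inlF x φ o

    free-inrF : (x : Var) (φ : Formula Σ₂) → FreeIn x (inrF φ) → FreeIn x φ
    free-inrF x (s ≐ t) (inj₁ o) = inj₁ (occ-inrT x s o)
    free-inrF x (s ≐ t) (inj₂ o) = inj₂ (occ-inrT x t o)
    free-inrF x (rel p ts) o = occ-inrV x ts o
    free-inrF x (¬' φ) o = free-inrF x φ o
    free-inrF x (φ ∧' ψ) (inj₁ o) = inj₁ (free-inrF x φ o)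
    free-inrF x (φ ∧' ψ) (inj₂ o) = inj₂ (free-inrF x ψ o)
    free-inrF x (φ ∨' ψ) (inj₁ o) = inj₁ (free-inrF x φ o)
    free-inrF x (φ ∨' ψ) (inj₂ o) = inj₂ (free-inrF x ψ o)
    free-inrF x (φ ⇒' ψ) (inj₁ o) = inj₁ (free-inrF x φ o)
    free-inrF x (φ ⇒' ψ) (inj₂ o) = inj₂ (free-inrF x ψ o)
    free-inrF x (∀' y φ) (ne , o) = ne , free-inrF x φ o
    free-inrF x (∃' y φ) (ne , o) = ne , free-inrF x φ o

  _⊔_ : Theory Σ₁ → Theory Σ₂ → Theory (Σ₁ ⊕ Σ₂)
  T₁ ⊔ T₂ = record
    { Ax = λ φ → (Σ (Formula Σ₁) λ ψ → Ax T₁ ψ × φ ≡ inlF ψ)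
               ⊎ (Σ (Formula Σ₂) λ ψ → Ax T₂ ψ × φ ≡ inrF ψ)
    ; Ax-sent = sent
    }
    where
    open import Relation.Binary.PropositionalEquality using (refl)
    sent : (φ : Formula (Σ₁ ⊕ Σ₂)) → _ → IsSentence φ
    sent .(inlF ψ) (inj₁ (ψ , a , refl)) x o = Ax-sent T₁ ψ a x (free-inlF x ψ o)
    sent .(inrF ψ) (inj₂ (ψ , a , refl)) x o = Ax-sent T₂ ψ a x (free-inrF x ψ o)

{-# OPTIONS --safe #-}
module Submission where

-- Bring φ into disjunctive normal form, purify each disjunct into a Σ₁-part and a
-- Σ₂-part sharing variables, and guess an arrangement of the shared variables. A
-- disjunct is satisfiable in T₁ ⊔ T₂ iff, for some arrangement, the two parts (each
-- with the arrangement) have models of a common cardinality: such models glue along a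
-- bijection respecting the arrangement, and by Löwenheim–Skolem only cardinalities in
-- ℕ_ω matter. If both spectra are infinite, their finite parts A ∈ 𝔉 and B with
-- ℕ ∖ B ∉ 𝔉 intersect, so a common finite size turns up when enumerating the computable
-- finite spectra. If one spectrum is finite, the decision procedure of its theory
-- eventually certifies that its models have at most m elements, after which the sizes
-- up to m are checked. Running both searches in parallel settles every candidate.

open import Defs
open import Level using (Lift; lift)
open import Data.Nat
  using (ℕ; zero; suc; _+_; _*_; _∸_; _≤_; _<_; z≤n; s≤s; _<?_; _≤?_; anyUpTo?; allUpTo?)
  renaming (_≟_ to _≟ℕ_; _⊔_ to _⊔ₙ_)
open import Data.Nat.Properties
open import Data.Nat.DivMod using (_mod_; m<n⇒m%n≡m)
open import Data.Nat.ListAction using (sum)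
open import Data.Bool using (Bool; true; false; T; not)
open import Data.Bool.Properties using (T-irrelevant)
import Data.Bool.Properties as Bool
open import Data.Maybe using (Maybe; just; nothing)
import Data.Maybe.Properties as Maybe
open import Data.Fin using (Fin; toℕ; fromℕ<) renaming (_≟_ to _≟F_)
open import Data.Fin.Properties using (toℕ-injective; toℕ<n; toℕ-fromℕ<; pigeonhole)
open import Data.Fin.Permutation using (Permutation′; _⟨$⟩ʳ_; _∘ₚ_; transpose) renaming (id to idₚ)
import Data.Fin.Permutation.Components as PC
open import Data.Vec using (Vec; []; _∷_)
import Data.Vec as Vec
open import Data.List
  using (List; []; _∷_; [_]; _++_; map; concat; concatMap; applyUpTo; upTo; cartesianProductWith)
open import Data.List.Membership.Propositional using (_∈_; find; lose)
open import Data.List.Relation.Unary.All using (All; []; _∷_; all?)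
import Data.List.Relation.Unary.All as All
import Data.List.Relation.Unary.All.Properties as All
open import Data.List.Relation.Unary.Any using (Any; here; there; any?)
import Data.List.Relation.Unary.Any as Any
import Data.List.Relation.Unary.Any.Properties as Any
open import Data.Product using (Σ; ∃; _×_; _,_; proj₁; proj₂)
open import Data.Sum using (_⊎_; inj₁; inj₂; [_,_]′) renaming (map to ⊎-map)
open import Data.Empty using (⊥-elim)
open import Data.Unit using (⊤; tt)
open import Relation.Nullary using (¬_; Dec; yes; no; does)
open import Relation.Nullary.Decidable using (isYes; toWitness; fromWitness; dec-true; _×-dec_; _⊎-dec_)
open import Relation.Unary using (Decidable)
open import Relation.Binary.Definitions using (DecidableEquality; tri<; tri≈; tri>)
open import Relation.Binary.PropositionalEquality
  using (_≡_; _≢_; _≗_; refl; sym; trans; cong; cong₂; subst; subst₂)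
open import Function using (_∘_; id)
open import Function.Bundles using (_↔_; _⇔_; Inverse; Injection; Equivalence; mk↔ₛ′; mk⇔)
open import Function.Definitions using (Injective)
open import Function.Properties.Inverse using (Inverse⇒Injection)
open import Function.Construct.Composition using (_↔-∘_; _⇔-∘_)
open import Function.Construct.Symmetry using (↔-sym; ⇔-sym)

-- Satisfaction and elementary embeddings

classical-Dec : Classical → (A : Set) → Dec A
classical-Dec cl A with cl (Lift _ A)
... | yes (lift a) = yes a
... | no ¬a = no (¬a ∘ lift)

Models : {Σ' : Signature} → Theory Σ' → (M : Structure Σ') → (Var → Dom M) → Set
Models {Σ'} T M ρ = (ψ : Formula Σ') → Ax T ψ → Sat M ρ ψ

HasModel : {Σ' : Signature} → Theory Σ' → Formula Σ' → Set₁
HasModel T = SatIn T (λ _ → ⊤)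

evalV-map : ∀ {Σ' : Signature} (M : Structure Σ') ρ {A : Set} {n} (h : A → Term Σ') (as : Vec A n) →
            evalV M ρ (Vec.map h as) ≡ Vec.map (evalT M ρ ∘ h) as
evalV-map M ρ h [] = refl
evalV-map M ρ h (a ∷ as) = cong (evalT M ρ (h a) ∷_) (evalV-map M ρ h as)

module _ {Σ' : Signature} (M : Structure Σ') where

  mutual
    evalT-agree : ∀ {ρ ρ'} t → (∀ x → OccT x t → ρ x ≡ ρ' x) → evalT M ρ t ≡ evalT M ρ' t
    evalT-agree (var x) h = h x refl
    evalT-agree (app f ts) h = cong (funI M f) (evalV-agree ts h)

    evalV-agree : ∀ {n ρ ρ'} (ts : Vec (Term Σ') n) → (∀ x → OccV x ts → ρ x ≡ ρ' x) →
                  evalV M ρ ts ≡ evalV M ρ' ts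
    evalV-agree [] h = refl
    evalV-agree (t ∷ ts) h = cong₂ _∷_ (evalT-agree t (λ x → h x ∘ inj₁)) (evalV-agree ts (λ x → h x ∘ inj₂))

  update-agree : ∀ {ρ ρ'} {P : Var → Set} x d → (∀ y → y ≢ x → P y → ρ y ≡ ρ' y) →
                 ∀ y → P y → update M ρ x d y ≡ update M ρ' x d y
  update-agree x d h y py with y ≟ℕ x
  ... | yes _ = refl
  ... | no y≢x = h y y≢x py

  Sat-agree : ∀ ψ {ρ ρ'} → (∀ x → FreeIn x ψ → ρ x ≡ ρ' x) → Sat M ρ ψ → Sat M ρ' ψ
  Sat-agree (s ≐ t) h s=t =
    trans (sym (evalT-agree s (λ x → h x ∘ inj₁))) (trans s=t (evalT-agree t (λ x → h x ∘ inj₂)))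
  Sat-agree (rel p ts) h = subst (predI M p) (evalV-agree ts h)
  Sat-agree (¬' ψ) h ¬ψ ψ' = ¬ψ (Sat-agree ψ (λ x → sym ∘ h x) ψ')
  Sat-agree (ψ ∧' χ) h (a , b) = Sat-agree ψ (λ x → h x ∘ inj₁) a , Sat-agree χ (λ x → h x ∘ inj₂) b
  Sat-agree (ψ ∨' χ) h (inj₁ a) = inj₁ (Sat-agree ψ (λ x → h x ∘ inj₁) a)
  Sat-agree (ψ ∨' χ) h (inj₂ b) = inj₂ (Sat-agree χ (λ x → h x ∘ inj₂) b)
  Sat-agree (ψ ⇒' χ) h f a =
    Sat-agree χ (λ x → h x ∘ inj₂) (f (Sat-agree ψ (λ x → sym ∘ h x ∘ inj₁) a))
  Sat-agree (∀' y ψ) h f d = Sat-agree ψ (update-agree y d (λ x x≢y → h x ∘ (x≢y ,_))) (f d)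
  Sat-agree (∃' y ψ) h (d , s) = d , Sat-agree ψ (update-agree y d (λ x x≢y → h x ∘ (x≢y ,_))) s

  Sat-≗ : ∀ ψ {ρ ρ'} → ρ ≗ ρ' → Sat M ρ ψ → Sat M ρ' ψ
  Sat-≗ ψ h = Sat-agree ψ (λ x _ → h x)

  Models-reassign : ∀ {T ρ ρ'} → Models T M ρ → Models T M ρ'
  Models-reassign {T} ⊨T ψ ax = Sat-agree ψ (λ x x∈ψ → ⊥-elim (Ax-sent T ψ ax x x∈ψ)) (⊨T ψ ax)

module TarskiVaught {Σ' : Signature} (cl : Classical) (M : Structure Σ') {A : Set} (a₀ : A)
  (e : A → Dom M) (e⁻¹ : Dom M → A) (e-injective : ∀ {a b} → e a ≡ e b → a ≡ b)
  (closed-fun : ∀ f (as : Vec A (funAr Σ' f)) → e (e⁻¹ (funI M f (Vec.map e as))) ≡ funI M f (Vec.map e as))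
  (witness : ∀ ψ (σ : Var → A) x d → Sat M (update M (e ∘ σ) x d) ψ →
               Σ A λ a → Sat M (update M (e ∘ σ) x (e a)) ψ) where

  induced : Structure Σ'
  induced = record
    { Dom = A ; inhab = a₀
    ; funI = λ f as → e⁻¹ (funI M f (Vec.map e as))
    ; predI = λ p as → predI M p (Vec.map e as) }

  mutual
    evalT-e : ∀ σ t → e (evalT induced σ t) ≡ evalT M (e ∘ σ) t
    evalT-e σ (var x) = refl
    evalT-e σ (app f ts) = trans (closed-fun f (evalV induced σ ts)) (cong (funI M f) (evalV-e σ ts))

    evalV-e : ∀ {n} σ (ts : Vec (Term Σ') n) → Vec.map e (evalV induced σ ts) ≡ evalV M (e ∘ σ) ts
    evalV-e σ [] = refl
    evalV-e σ (t ∷ ts) = cong₂ _∷_ (evalT-e σ t) (evalV-e σ ts)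

  update-e : ∀ σ x a → e ∘ update induced σ x a ≗ update M (e ∘ σ) x (e a)
  update-e σ x a y with y ≟ℕ x
  ... | yes _ = refl
  ... | no _ = refl

  mutual
    preserves : ∀ ψ σ → Sat induced σ ψ → Sat M (e ∘ σ) ψ
    preserves (s ≐ t) σ s=t = trans (sym (evalT-e σ s)) (trans (cong e s=t) (evalT-e σ t))
    preserves (rel p ts) σ = subst (predI M p) (evalV-e σ ts)
    preserves (¬' ψ) σ ¬ψ ψ' = ¬ψ (reflects ψ σ ψ')
    preserves (ψ ∧' χ) σ (a , b) = preserves ψ σ a , preserves χ σ b
    preserves (ψ ∨' χ) σ (inj₁ a) = inj₁ (preserves ψ σ a)
    preserves (ψ ∨' χ) σ (inj₂ b) = inj₂ (preserves χ σ b)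
    preserves (ψ ⇒' χ) σ f a = preserves χ σ (f (reflects ψ σ a))
    preserves (∀' x ψ) σ f d with classical-Dec cl (Sat M (update M (e ∘ σ) x d) ψ)
    ... | yes s = s
    ... | no ¬s with witness (¬' ψ) σ x d ¬s
    ...   | a , ¬sa = ⊥-elim (¬sa (Sat-≗ M ψ (update-e σ x a) (preserves ψ (update induced σ x a) (f a))))
    preserves (∃' x ψ) σ (a , s) = e a , Sat-≗ M ψ (update-e σ x a) (preserves ψ (update induced σ x a) s)

    reflects : ∀ ψ σ → Sat M (e ∘ σ) ψ → Sat induced σ ψ
    reflects (s ≐ t) σ s=t = e-injective (trans (evalT-e σ s) (trans s=t (sym (evalT-e σ t))))
    reflects (rel p ts) σ = subst (predI M p) (sym (evalV-e σ ts))
    reflects (¬' ψ) σ ¬ψ ψ' = ¬ψ (preserves ψ σ ψ')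
    reflects (ψ ∧' χ) σ (a , b) = reflects ψ σ a , reflects χ σ b
    reflects (ψ ∨' χ) σ (inj₁ a) = inj₁ (reflects ψ σ a)
    reflects (ψ ∨' χ) σ (inj₂ b) = inj₂ (reflects χ σ b)
    reflects (ψ ⇒' χ) σ f a = reflects χ σ (f (preserves ψ σ a))
    reflects (∀' x ψ) σ f a =
      reflects ψ (update induced σ x a) (Sat-≗ M ψ (sym ∘ update-e σ x a) (f (e a)))
    reflects (∃' x ψ) σ (d , s) with witness ψ σ x d s
    ... | a , sa = a , reflects ψ (update induced σ x a) (Sat-≗ M ψ (sym ∘ update-e σ x a) sa)

-- Coding terms and formulas by numbers

-- ⟪ a , b ⟫ = 2ᵃ (2b + 1); opaque, so that equations between codes are solved by
-- comparing arguments.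
opaque
  ⟪_,_⟫ : ℕ → ℕ → ℕ
  ⟪ zero , b ⟫ = suc (2 * b)
  ⟪ suc a , b ⟫ = 2 * ⟪ a , b ⟫

  ⟪⟫-injective : ∀ {a b a' b'} → ⟪ a , b ⟫ ≡ ⟪ a' , b' ⟫ → a ≡ a' × b ≡ b'
  ⟪⟫-injective {zero} {b} {zero} {b'} eq = refl , *-cancelˡ-≡ b b' 2 (suc-injective eq)
  ⟪⟫-injective {zero} {b} {suc a'} {b'} eq = ⊥-elim (even≢odd ⟪ a' , b' ⟫ b (sym eq))
  ⟪⟫-injective {suc a} {b} {zero} {b'} eq = ⊥-elim (even≢odd ⟪ a , b ⟫ b' eq)
  ⟪⟫-injective {suc a} {_} {suc a'} eq with ⟪⟫-injective {a} {_} {a'} (*-cancelˡ-≡ _ _ 2 eq)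
  ... | refl , refl = refl , refl

module Coding (Σ' : Signature) where

  mutual
    codeT : Term Σ' → ℕ
    codeT (var x) = ⟪ 0 , x ⟫
    codeT (app f ts) = ⟪ suc (encF Σ' f) , codeV ts ⟫

    codeV : ∀ {n} → Vec (Term Σ') n → ℕ
    codeV [] = 0
    codeV (t ∷ ts) = suc ⟪ codeT t , codeV ts ⟫

  mutual
    codeT-injective : Injective _≡_ _≡_ codeT
    codeT-injective {var x} {var y} eq = cong var (proj₂ (⟪⟫-injective eq))
    codeT-injective {var x} {app g us} eq with () ← proj₁ (⟪⟫-injective eq)
    codeT-injective {app f ts} {var y} eq with () ← proj₁ (⟪⟫-injective eq)
    codeT-injective {app f ts} {app g us} eq with ⟪⟫-injective eq
    ... | f≡g , ts≡us with encF-inj Σ' (suc-injective f≡g)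
    ...   | refl = cong (app f) (codeV-injective ts≡us)

    codeV-injective : ∀ {n} → Injective _≡_ _≡_ (codeV {n})
    codeV-injective {x = []} {[]} _ = refl
    codeV-injective {x = t ∷ ts} {u ∷ us} eq with ⟪⟫-injective (suc-injective eq)
    ... | t≡u , ts≡us = cong₂ _∷_ (codeT-injective t≡u) (codeV-injective ts≡us)

  -- Separating the tag lets Agda discard the mixed cases of injectivity by itself.
  tag : Formula Σ' → ℕ
  tag (_ ≐ _) = 0
  tag (rel _ _) = 1
  tag (¬' _) = 2
  tag (_ ∧' _) = 3
  tag (_ ∨' _) = 4
  tag (_ ⇒' _) = 5
  tag (∀' _ _) = 6
  tag (∃' _ _) = 7

  mutual
    codeF : Formula Σ' → ℕ
    codeF ψ = ⟪ tag ψ , fields ψ ⟫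

    fields : Formula Σ' → ℕ
    fields (s ≐ t) = ⟪ codeT s , codeT t ⟫
    fields (rel p ts) = ⟪ encP Σ' p , codeV ts ⟫
    fields (¬' ψ) = codeF ψ
    fields (ψ ∧' χ) = ⟪ codeF ψ , codeF χ ⟫
    fields (ψ ∨' χ) = ⟪ codeF ψ , codeF χ ⟫
    fields (ψ ⇒' χ) = ⟪ codeF ψ , codeF χ ⟫
    fields (∀' x ψ) = ⟪ x , codeF ψ ⟫
    fields (∃' x ψ) = ⟪ x , codeF ψ ⟫

  mutual
    codeF-injective : ∀ ψ χ → codeF ψ ≡ codeF χ → ψ ≡ χ
    codeF-injective ψ χ eq = fields-injective ψ χ (proj₁ (⟪⟫-injective eq)) (proj₂ (⟪⟫-injective eq))

    fields-injective : ∀ ψ χ → tag ψ ≡ tag χ → fields ψ ≡ fields χ → ψ ≡ χ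
    fields-injective (s ≐ t) (s' ≐ t') _ eq =
      cong₂ _≐_ (codeT-injective (proj₁ (⟪⟫-injective eq))) (codeT-injective (proj₂ (⟪⟫-injective eq)))
    fields-injective (rel p ts) (rel q us) _ eq with ⟪⟫-injective eq
    ... | p≡q , ts≡us with encP-inj Σ' p≡q
    ...   | refl = cong (rel p) (codeV-injective ts≡us)
    fields-injective (¬' ψ) (¬' χ) _ eq = cong ¬'_ (codeF-injective ψ χ eq)
    fields-injective (ψ ∧' χ) (ψ' ∧' χ') _ eq = cong₂ _∧'_ (codeF-injectiveˡ ψ ψ' eq) (codeF-injectiveʳ χ χ' eq)
    fields-injective (ψ ∨' χ) (ψ' ∨' χ') _ eq = cong₂ _∨'_ (codeF-injectiveˡ ψ ψ' eq) (codeF-injectiveʳ χ χ' eq)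
    fields-injective (ψ ⇒' χ) (ψ' ⇒' χ') _ eq = cong₂ _⇒'_ (codeF-injectiveˡ ψ ψ' eq) (codeF-injectiveʳ χ χ' eq)
    fields-injective (∀' x ψ) (∀' y χ) _ eq = cong₂ ∀' (proj₁ (⟪⟫-injective eq)) (codeF-injectiveʳ ψ χ eq)
    fields-injective (∃' x ψ) (∃' y χ) _ eq = cong₂ ∃' (proj₁ (⟪⟫-injective eq)) (codeF-injectiveʳ ψ χ eq)

    codeF-injectiveˡ : ∀ ψ ψ' {a a'} → ⟪ codeF ψ , a ⟫ ≡ ⟪ codeF ψ' , a' ⟫ → ψ ≡ ψ'
    codeF-injectiveˡ ψ ψ' eq = codeF-injective ψ ψ' (proj₁ (⟪⟫-injective eq))

    codeF-injectiveʳ : ∀ ψ ψ' {a a'} → ⟪ a , codeF ψ ⟫ ≡ ⟪ a' , codeF ψ' ⟫ → ψ ≡ ψ'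
    codeF-injectiveʳ ψ ψ' eq = codeF-injective ψ ψ' (proj₂ (⟪⟫-injective eq))

-- Downward Löwenheim–Skolem

least : {P : ℕ → Set} → Decidable P → ∀ n → P n → ∃ λ m → m ≤ n × P m × (∀ {j} → j < m → ¬ P j)
least P? zero p = 0 , z≤n , p , λ ()
least P? (suc n) p with P? 0
... | yes p₀ = 0 , z≤n , p₀ , λ ()
... | no ¬p₀ with least (P? ∘ suc) n p
...   | m , m≤n , pm , below = suc m , s≤s m≤n , pm , λ { {zero} _ → ¬p₀ ; {suc j} (s≤s j<m) → below j<m }

module FirstOccurrence {D : Set} (_≟_ : DecidableEquality D) (f : ℕ → D) where

  first : ℕ → ℕ
  first i = proj₁ (least (λ j → f j ≟ f i) i refl)

  first-≤ : ∀ i → first i ≤ i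
  first-≤ i = proj₁ (proj₂ (least (λ j → f j ≟ f i) i refl))

  f-first : ∀ i → f (first i) ≡ f i
  f-first i = proj₁ (proj₂ (proj₂ (least (λ j → f j ≟ f i) i refl)))

  before-first : ∀ i {j} → j < first i → f j ≢ f i
  before-first i = proj₂ (proj₂ (proj₂ (least (λ j → f j ≟ f i) i refl)))

  first-cong : ∀ {i j} → f i ≡ f j → first i ≡ first j
  first-cong {i} {j} fi≡fj with <-cmp (first i) (first j)
  ... | tri≈ _ eq _ = eq
  ... | tri< lt _ _ = ⊥-elim (before-first j lt (trans (f-first i) fi≡fj))
  ... | tri> _ _ gt = ⊥-elim (before-first i gt (trans (f-first j) (sym fi≡fj)))

  first-idem : ∀ i → first (first i) ≡ first i
  first-idem i = first-cong (f-first i)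

-- An element of the subset is sent to the number of elements below it.
module Counting (P : ℕ → Bool) where

  Subset : Set
  Subset = Σ ℕ (T ∘ P)

  ≡-Subset : ∀ {k k'} {p : T (P k)} {p' : T (P k')} → k ≡ k' → (k , p) ≡ (k' , p')
  ≡-Subset refl = cong (_ ,_) (T-irrelevant _ _)

  count : ℕ → ℕ
  count zero = 0
  count (suc n) with P n
  ... | true = suc (count n)
  ... | false = count n

  count-step : ∀ n → count n ≤ count (suc n)
  count-step n with P n
  ... | true = n≤1+n _
  ... | false = ≤-refl

  count-mono : ∀ {m n} → m ≤ n → count m ≤ count n
  count-mono {n = zero} z≤n = ≤-refl
  count-mono {m} {suc n} m≤1+n with m ≟ℕ suc n
  ... | yes refl = ≤-refl
  ... | no m≢1+n = ≤-trans (count-mono (m<1+n⇒m≤n (≤∧≢⇒< m≤1+n m≢1+n))) (count-step n)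

  count-member : ∀ k → T (P k) → count k < count (suc k)
  count-member k p with P k
  ... | true = ≤-refl

  count-injective : ∀ {k k'} → T (P k) → T (P k') → count k ≡ count k' → k ≡ k'
  count-injective {k} {k'} p p' eq with <-cmp k k'
  ... | tri≈ _ k≡k' _ = k≡k'
  ... | tri< lt _ _ = ⊥-elim (<-irrefl eq (<-≤-trans (count-member k p) (count-mono lt)))
  ... | tri> _ _ gt = ⊥-elim (<-irrefl (sym eq) (<-≤-trans (count-member k' p') (count-mono gt)))

  select : ∀ n i → i < count n → Σ ℕ λ k → T (P k) × count k ≡ i
  select (suc n) i i<count with P n in Pn
  ... | false = select n i i<count
  ... | true with i ≟ℕ count n
  ...   | yes refl = n , subst T (sym Pn) _ , refl
  ...   | no i≢count = select n i (≤∧≢⇒< (m<1+n⇒m≤n i<count) i≢count)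

  selected : ∀ n {i} (i<count : i < count n) → count (proj₁ (select n i i<count)) ≡ i
  selected n {i} i<count = proj₂ (proj₂ (select n i i<count))

  finite : ∀ B → (∀ {k} → B ≤ k → ¬ T (P k)) → Subset ↔ Fin (count B)
  finite B above = mk↔ₛ′ to from to∘from from∘to
    where
    count<count : ∀ {k} → T (P k) → count k < count B
    count<count {k} p with k <? B
    ... | yes k<B = <-≤-trans (count-member k p) (count-mono k<B)
    ... | no k≮B = ⊥-elim (above (≮⇒≥ k≮B) p)
    to : Subset → Fin (count B)
    to (k , p) = fromℕ< (count<count p)
    from : Fin (count B) → Subset
    from i = proj₁ (select B (toℕ i) (toℕ<n i)) , proj₁ (proj₂ (select B (toℕ i) (toℕ<n i)))
    to∘from : ∀ i → to (from i) ≡ i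
    to∘from i = toℕ-injective (trans (toℕ-fromℕ< _) (selected B (toℕ<n i)))
    from∘to : ∀ a → from (to a) ≡ a
    from∘to (k , p) = ≡-Subset (count-injective (proj₂ (from (to (k , p)))) p
                                  (trans (selected B (toℕ<n (to (k , p)))) (toℕ-fromℕ< _)))

  infinite : (∀ n → ∃ λ k → n ≤ k × T (P k)) → Subset ↔ ℕ
  infinite unbounded = mk↔ₛ′ to from selected-large from∘to
    where
    large : ∀ i → ∃ λ n → i < count n
    large zero with unbounded 0
    ... | k , _ , p = suc k , ≤-<-trans z≤n (count-member k p)
    large (suc i) with large i
    ... | n , i<count with unbounded n
    ...   | k , n≤k , p = suc k , ≤-<-trans (≤-trans i<count (count-mono n≤k)) (count-member k p)
    to : Subset → ℕ
    to (k , _) = count k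
    from : ℕ → Subset
    from i = proj₁ selection , proj₁ (proj₂ selection)
      where selection = select (proj₁ (large i)) i (proj₂ (large i))
    selected-large : ∀ i → to (from i) ≡ i
    selected-large i = selected (proj₁ (large i)) (proj₂ (large i))
    from∘to : ∀ a → from (to a) ≡ a
    from∘to (k , p) = ≡-Subset (count-injective (proj₂ (from (count k))) p (selected-large (count k)))

  cardinality : Classical → Σ ℕω λ c → HasCard c Subset
  cardinality cl with classical-Dec cl (∃ λ B → ∀ {k} → B ≤ k → ¬ T (P k))
  ... | yes (B , above) = fin (count B) , finite B above
  ... | no unbounded = ℵ₀ , infinite beyond
    where
    beyond : ∀ n → ∃ λ k → n ≤ k × T (P k)
    beyond n with classical-Dec cl (∃ λ k → n ≤ k × T (P k))
    ... | yes found = found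
    ... | no none = ⊥-elim (unbounded (n , λ {k} n≤k p → none (k , n≤k , p)))

module _ {Σ' : Signature} where

  mutual
    fvBoundT : Term Σ' → ℕ
    fvBoundT (var x) = suc x
    fvBoundT (app f ts) = fvBoundV ts

    fvBoundV : ∀ {n} → Vec (Term Σ') n → ℕ
    fvBoundV [] = 0
    fvBoundV (t ∷ ts) = fvBoundT t ⊔ₙ fvBoundV ts

  fvBound : Formula Σ' → ℕ
  fvBound (s ≐ t) = fvBoundT s ⊔ₙ fvBoundT t
  fvBound (rel p ts) = fvBoundV ts
  fvBound (¬' ψ) = fvBound ψ
  fvBound (ψ ∧' χ) = fvBound ψ ⊔ₙ fvBound χ
  fvBound (ψ ∨' χ) = fvBound ψ ⊔ₙ fvBound χ
  fvBound (ψ ⇒' χ) = fvBound ψ ⊔ₙ fvBound χ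
  fvBound (∀' x ψ) = fvBound ψ
  fvBound (∃' x ψ) = fvBound ψ

  private
    <-⊔ : ∀ {x m n} → x < m ⊎ x < n → x < m ⊔ₙ n
    <-⊔ {n = n} (inj₁ x<m) = m<n⇒m<n⊔o n x<m
    <-⊔ {m = m} (inj₂ x<n) = m<n⇒m<o⊔n m x<n

  mutual
    occT<fvBoundT : ∀ {x} t → OccT x t → x < fvBoundT t
    occT<fvBoundT (var x) refl = n<1+n x
    occT<fvBoundT (app f ts) = occV<fvBoundV ts

    occV<fvBoundV : ∀ {x n} (ts : Vec (Term Σ') n) → OccV x ts → x < fvBoundV ts
    occV<fvBoundV (t ∷ ts) = <-⊔ ∘ ⊎-map (occT<fvBoundT t) (occV<fvBoundV ts)

  free<fvBound : ∀ {x} ψ → FreeIn x ψ → x < fvBound ψ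
  free<fvBound (s ≐ t) = <-⊔ ∘ ⊎-map (occT<fvBoundT s) (occT<fvBoundT t)
  free<fvBound (rel p ts) = occV<fvBoundV ts
  free<fvBound (¬' ψ) = free<fvBound ψ
  free<fvBound (ψ ∧' χ) = <-⊔ ∘ ⊎-map (free<fvBound ψ) (free<fvBound χ)
  free<fvBound (ψ ∨' χ) = <-⊔ ∘ ⊎-map (free<fvBound ψ) (free<fvBound χ)
  free<fvBound (ψ ⇒' χ) = <-⊔ ∘ ⊎-map (free<fvBound ψ) (free<fvBound χ)
  free<fvBound (∀' x ψ) = free<fvBound ψ ∘ proj₂
  free<fvBound (∃' x ψ) = free<fvBound ψ ∘ proj₂

-- The countable submodel is the set of values of terms in the Skolem expansion,
-- enumerated through their codes; each value is represented by its first code.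
module LöwenheimSkolem {Σ' : Signature} (cl : Classical) (M : Structure Σ') (ρ : Var → Dom M) where
  open Coding Σ' using (codeF; codeF-injective)

  D : Set
  D = Dom M

  SkolemSym : Set
  SkolemSym = Formula Σ' × Var × ℕ

  codeSkolem : SkolemSym → ℕ
  codeSkolem (ψ , x , n) = ⟪ codeF ψ , ⟪ x , n ⟫ ⟫

  codeSkolem-injective : ∀ {s s'} → codeSkolem s ≡ codeSkolem s' → s ≡ s'
  codeSkolem-injective {ψ , _} {χ , _} eq
    with codeF-injective ψ χ (proj₁ (⟪⟫-injective eq)) | ⟪⟫-injective (proj₂ (⟪⟫-injective eq))
  ... | refl | refl , refl = refl

  Σˢ : Signature
  Σˢ = record
    { FunSym = FunSym Σ' ⊎ SkolemSym
    ; PredSym = PredSym Σ'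
    ; funAr = [ funAr Σ' , proj₂ ∘ proj₂ ]′
    ; predAr = predAr Σ'
    ; encF = enc⊎ (encF Σ') codeSkolem
    ; encF-inj = encInj (encF Σ') codeSkolem (encF-inj Σ') codeSkolem-injective
    ; encP = encP Σ'
    ; encP-inj = encP-inj Σ' }

  open Coding Σˢ using (codeT; codeT-injective)

  envOf : ∀ {n} → Vec D n → Var → D
  envOf [] _ = inhab M
  envOf (d ∷ ds) zero = d
  envOf (d ∷ ds) (suc y) = envOf ds y

  skolem : Formula Σ' → Var → ∀ {n} → Vec D n → D
  skolem ψ x ds with classical-Dec cl (Σ D λ d → Sat M (update M (envOf ds) x d) ψ)
  ... | yes (d , _) = d
  ... | no _ = inhab M

  skolem-witness : ∀ ψ x {n} (ds : Vec D n) d → Sat M (update M (envOf ds) x d) ψ →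
                   Sat M (update M (envOf ds) x (skolem ψ x ds)) ψ
  skolem-witness ψ x ds d sat with classical-Dec cl (Σ D λ d → Sat M (update M (envOf ds) x d) ψ)
  ... | yes (_ , sat') = sat'
  ... | no none = ⊥-elim (none (d , sat))

  Mˢ : Structure Σˢ
  Mˢ = record
    { Dom = D ; inhab = inhab M
    ; funI = λ { (inj₁ f) → funI M f ; (inj₂ (ψ , x , _)) → skolem ψ x }
    ; predI = predI M }

  value : Term Σˢ → D
  value = evalT Mˢ ρ

  termAt : ℕ → Term Σˢ
  termAt k with classical-Dec cl (Σ (Term Σˢ) λ t → codeT t ≡ k)
  ... | yes (t , _) = t
  ... | no _ = var 0

  termAt-codeT : ∀ t → termAt (codeT t) ≡ t
  termAt-codeT t with classical-Dec cl (Σ (Term Σˢ) λ t' → codeT t' ≡ codeT t)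
  ... | yes (t' , eq) = codeT-injective eq
  ... | no none = ⊥-elim (none (t , refl))

  v : ℕ → D
  v = value ∘ termAt

  open FirstOccurrence (λ d d' → classical-Dec cl (d ≡ d')) v

  isNew : ℕ → Bool
  isNew k = isYes (first k ≟ℕ k)

  open Counting isNew using (≡-Subset; cardinality) renaming (Subset to Hull)

  countable : Σ ℕω λ c → HasCard c Hull
  countable = cardinality cl

  e : Hull → D
  e = v ∘ proj₁

  first-isNew : ∀ k → T (isNew (first k))
  first-isNew k = fromWitness (first-idem k)

  e-injective : ∀ {a b} → e a ≡ e b → a ≡ b
  e-injective {k , new} {k' , new'} eq = ≡-Subset (trans (sym (toWitness new)) (trans (first-cong eq) (toWitness new')))

  e⁻¹ : D → Hull
  e⁻¹ d with classical-Dec cl (∃ λ k → v k ≡ d)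
  ... | yes (k , _) = first k , first-isNew k
  ... | no _ = first 0 , first-isNew 0

  e-e⁻¹ : ∀ t → e (e⁻¹ (value t)) ≡ value t
  e-e⁻¹ t with classical-Dec cl (∃ λ k → v k ≡ value t)
  ... | yes (k , vk≡) = trans (f-first k) vk≡
  ... | no none = ⊥-elim (none (codeT t , cong value (termAt-codeT t)))

  termOf : Hull → Term Σˢ
  termOf = termAt ∘ proj₁

  closed-fun : ∀ f (as : Vec Hull (funAr Σ' f)) → e (e⁻¹ (funI M f (Vec.map e as))) ≡ funI M f (Vec.map e as)
  closed-fun f as = subst (λ ds → e (e⁻¹ (funI M f ds)) ≡ funI M f ds)
                          (evalV-map Mˢ ρ termOf as) (e-e⁻¹ (app (inj₁ f) (Vec.map termOf as)))

  envOf-tabulate : ∀ n (h : ℕ → Term Σˢ) {y} → y < n →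
                   envOf (evalV Mˢ ρ (Vec.tabulate {n = n} (h ∘ toℕ))) y ≡ value (h y)
  envOf-tabulate (suc n) h {zero} _ = refl
  envOf-tabulate (suc n) h {suc y} (s≤s y<n) = envOf-tabulate n (h ∘ suc) y<n

  witness : ∀ ψ (σ : Var → Hull) x d → Sat M (update M (e ∘ σ) x d) ψ →
            Σ Hull λ a → Sat M (update M (e ∘ σ) x (e a)) ψ
  witness ψ σ x d sat =
    e⁻¹ (value skolemTerm) , subst (λ d' → Sat M (update M (e ∘ σ) x d') ψ) (sym (e-e⁻¹ skolemTerm)) sat'
    where
    args : Vec (Term Σˢ) (fvBound ψ)
    args = Vec.tabulate (termOf ∘ σ ∘ toℕ)
    skolemTerm : Term Σˢ
    skolemTerm = app (inj₂ (ψ , x , fvBound ψ)) args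
    agree : ∀ y → y ≢ x → FreeIn y ψ → e (σ y) ≡ envOf (evalV Mˢ ρ args) y
    agree y _ y∈ψ = sym (envOf-tabulate (fvBound ψ) (termOf ∘ σ) (free<fvBound ψ y∈ψ))
    sat' : Sat M (update M (e ∘ σ) x (value skolemTerm)) ψ
    sat' = Sat-agree M ψ (update-agree M x _ (λ y y≢x → sym ∘ agree y y≢x))
             (skolem-witness ψ x _ d (Sat-agree M ψ (update-agree M x d agree) sat))

  open TarskiVaught cl M (e⁻¹ (inhab M)) e e⁻¹ e-injective closed-fun witness public using (induced)
  open TarskiVaught cl M (e⁻¹ (inhab M)) e e⁻¹ e-injective closed-fun witness using (reflects)

  ρ' : Var → Hull
  ρ' = e⁻¹ ∘ ρ

  elementary : ∀ ψ → Sat M ρ ψ → Sat induced ρ' ψ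
  elementary ψ = reflects ψ ρ' ∘ Sat-≗ M ψ (λ x → sym (e-e⁻¹ (var x)))

löwenheim-skolem : ∀ {Σ'} → Classical → (M : Structure Σ') (ρ : Var → Dom M) →
  Σ ℕω λ c → Σ (Structure Σ') λ M' → Σ (Var → Dom M') λ ρ' →
    HasCard c (Dom M') × (∀ ψ → Sat M ρ ψ → Sat M' ρ' ψ)
löwenheim-skolem cl M ρ = proj₁ countable , induced , ρ' , proj₂ countable , elementary
  where open LöwenheimSkolem cl M ρ

-- Reducts and amalgamation

module _ {Σ₁ Σ₂ : Signature} where

  reduct₁ : Structure (Σ₁ ⊕ Σ₂) → Structure Σ₁
  reduct₁ C = record { Dom = Dom C ; inhab = inhab C ; funI = funI C ∘ inj₁ ; predI = predI C ∘ inj₁ }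

  reduct₂ : Structure (Σ₁ ⊕ Σ₂) → Structure Σ₂
  reduct₂ C = record { Dom = Dom C ; inhab = inhab C ; funI = funI C ∘ inj₂ ; predI = predI C ∘ inj₂ }

  module _ (C : Structure (Σ₁ ⊕ Σ₂)) where

    update-reduct₁ : ∀ ρ x d → update C ρ x d ≗ update (reduct₁ C) ρ x d
    update-reduct₁ ρ x d y with y ≟ℕ x
    ... | yes _ = refl
    ... | no _ = refl

    update-reduct₂ : ∀ ρ x d → update C ρ x d ≗ update (reduct₂ C) ρ x d
    update-reduct₂ ρ x d y with y ≟ℕ x
    ... | yes _ = refl
    ... | no _ = refl

    mutual
      evalT-inlT : ∀ ρ t → evalT C ρ (inlT {Σ₁} {Σ₂} t) ≡ evalT (reduct₁ C) ρ t
      evalT-inlT ρ (var x) = refl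
      evalT-inlT ρ (app f ts) = cong (funI C (inj₁ f)) (evalV-inlV ρ ts)

      evalV-inlV : ∀ {n} ρ (ts : Vec (Term Σ₁) n) → evalV C ρ (inlV {Σ₁} {Σ₂} ts) ≡ evalV (reduct₁ C) ρ ts
      evalV-inlV ρ [] = refl
      evalV-inlV ρ (t ∷ ts) = cong₂ _∷_ (evalT-inlT ρ t) (evalV-inlV ρ ts)

    mutual
      evalT-inrT : ∀ ρ t → evalT C ρ (inrT {Σ₁} {Σ₂} t) ≡ evalT (reduct₂ C) ρ t
      evalT-inrT ρ (var x) = refl
      evalT-inrT ρ (app f ts) = cong (funI C (inj₂ f)) (evalV-inrV ρ ts)

      evalV-inrV : ∀ {n} ρ (ts : Vec (Term Σ₂) n) → evalV C ρ (inrV {Σ₁} {Σ₂} ts) ≡ evalV (reduct₂ C) ρ ts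
      evalV-inrV ρ [] = refl
      evalV-inrV ρ (t ∷ ts) = cong₂ _∷_ (evalT-inrT ρ t) (evalV-inrV ρ ts)

    mutual
      Sat-inlF⁻ : ∀ ψ ρ → Sat C ρ (inlF {Σ₁} {Σ₂} ψ) → Sat (reduct₁ C) ρ ψ
      Sat-inlF⁻ (s ≐ t) ρ s=t = trans (sym (evalT-inlT ρ s)) (trans s=t (evalT-inlT ρ t))
      Sat-inlF⁻ (rel p ts) ρ = subst (predI C (inj₁ p)) (evalV-inlV ρ ts)
      Sat-inlF⁻ (¬' ψ) ρ ¬ψ = ¬ψ ∘ Sat-inlF⁺ ψ ρ
      Sat-inlF⁻ (ψ ∧' χ) ρ (a , b) = Sat-inlF⁻ ψ ρ a , Sat-inlF⁻ χ ρ b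
      Sat-inlF⁻ (ψ ∨' χ) ρ (inj₁ a) = inj₁ (Sat-inlF⁻ ψ ρ a)
      Sat-inlF⁻ (ψ ∨' χ) ρ (inj₂ b) = inj₂ (Sat-inlF⁻ χ ρ b)
      Sat-inlF⁻ (ψ ⇒' χ) ρ f = Sat-inlF⁻ χ ρ ∘ f ∘ Sat-inlF⁺ ψ ρ
      Sat-inlF⁻ (∀' x ψ) ρ f d = Sat-≗ (reduct₁ C) ψ (update-reduct₁ ρ x d) (Sat-inlF⁻ ψ _ (f d))
      Sat-inlF⁻ (∃' x ψ) ρ (d , s) = d , Sat-≗ (reduct₁ C) ψ (update-reduct₁ ρ x d) (Sat-inlF⁻ ψ _ s)

      Sat-inlF⁺ : ∀ ψ ρ → Sat (reduct₁ C) ρ ψ → Sat C ρ (inlF {Σ₁} {Σ₂} ψ)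
      Sat-inlF⁺ (s ≐ t) ρ s=t = trans (evalT-inlT ρ s) (trans s=t (sym (evalT-inlT ρ t)))
      Sat-inlF⁺ (rel p ts) ρ = subst (predI C (inj₁ p)) (sym (evalV-inlV ρ ts))
      Sat-inlF⁺ (¬' ψ) ρ ¬ψ = ¬ψ ∘ Sat-inlF⁻ ψ ρ
      Sat-inlF⁺ (ψ ∧' χ) ρ (a , b) = Sat-inlF⁺ ψ ρ a , Sat-inlF⁺ χ ρ b
      Sat-inlF⁺ (ψ ∨' χ) ρ (inj₁ a) = inj₁ (Sat-inlF⁺ ψ ρ a)
      Sat-inlF⁺ (ψ ∨' χ) ρ (inj₂ b) = inj₂ (Sat-inlF⁺ χ ρ b)
      Sat-inlF⁺ (ψ ⇒' χ) ρ f = Sat-inlF⁺ χ ρ ∘ f ∘ Sat-inlF⁻ ψ ρ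
      Sat-inlF⁺ (∀' x ψ) ρ f d = Sat-inlF⁺ ψ _ (Sat-≗ (reduct₁ C) ψ (sym ∘ update-reduct₁ ρ x d) (f d))
      Sat-inlF⁺ (∃' x ψ) ρ (d , s) = d , Sat-inlF⁺ ψ _ (Sat-≗ (reduct₁ C) ψ (sym ∘ update-reduct₁ ρ x d) s)

    mutual
      Sat-inrF⁻ : ∀ ψ ρ → Sat C ρ (inrF {Σ₁} {Σ₂} ψ) → Sat (reduct₂ C) ρ ψ
      Sat-inrF⁻ (s ≐ t) ρ s=t = trans (sym (evalT-inrT ρ s)) (trans s=t (evalT-inrT ρ t))
      Sat-inrF⁻ (rel p ts) ρ = subst (predI C (inj₂ p)) (evalV-inrV ρ ts)
      Sat-inrF⁻ (¬' ψ) ρ ¬ψ = ¬ψ ∘ Sat-inrF⁺ ψ ρ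
      Sat-inrF⁻ (ψ ∧' χ) ρ (a , b) = Sat-inrF⁻ ψ ρ a , Sat-inrF⁻ χ ρ b
      Sat-inrF⁻ (ψ ∨' χ) ρ (inj₁ a) = inj₁ (Sat-inrF⁻ ψ ρ a)
      Sat-inrF⁻ (ψ ∨' χ) ρ (inj₂ b) = inj₂ (Sat-inrF⁻ χ ρ b)
      Sat-inrF⁻ (ψ ⇒' χ) ρ f = Sat-inrF⁻ χ ρ ∘ f ∘ Sat-inrF⁺ ψ ρ
      Sat-inrF⁻ (∀' x ψ) ρ f d = Sat-≗ (reduct₂ C) ψ (update-reduct₂ ρ x d) (Sat-inrF⁻ ψ _ (f d))
      Sat-inrF⁻ (∃' x ψ) ρ (d , s) = d , Sat-≗ (reduct₂ C) ψ (update-reduct₂ ρ x d) (Sat-inrF⁻ ψ _ s)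

      Sat-inrF⁺ : ∀ ψ ρ → Sat (reduct₂ C) ρ ψ → Sat C ρ (inrF {Σ₁} {Σ₂} ψ)
      Sat-inrF⁺ (s ≐ t) ρ s=t = trans (evalT-inrT ρ s) (trans s=t (sym (evalT-inrT ρ t)))
      Sat-inrF⁺ (rel p ts) ρ = subst (predI C (inj₂ p)) (sym (evalV-inrV ρ ts))
      Sat-inrF⁺ (¬' ψ) ρ ¬ψ = ¬ψ ∘ Sat-inrF⁻ ψ ρ
      Sat-inrF⁺ (ψ ∧' χ) ρ (a , b) = Sat-inrF⁺ ψ ρ a , Sat-inrF⁺ χ ρ b
      Sat-inrF⁺ (ψ ∨' χ) ρ (inj₁ a) = inj₁ (Sat-inrF⁺ ψ ρ a)
      Sat-inrF⁺ (ψ ∨' χ) ρ (inj₂ b) = inj₂ (Sat-inrF⁺ χ ρ b)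
      Sat-inrF⁺ (ψ ⇒' χ) ρ f = Sat-inrF⁺ χ ρ ∘ f ∘ Sat-inrF⁻ ψ ρ
      Sat-inrF⁺ (∀' x ψ) ρ f d = Sat-inrF⁺ ψ _ (Sat-≗ (reduct₂ C) ψ (sym ∘ update-reduct₂ ρ x d) (f d))
      Sat-inrF⁺ (∃' x ψ) ρ (d , s) = d , Sat-inrF⁺ ψ _ (Sat-≗ (reduct₂ C) ψ (sym ∘ update-reduct₂ ρ x d) s)

  module _ (T₁ : Theory Σ₁) (T₂ : Theory Σ₂) (C : Structure (Σ₁ ⊕ Σ₂)) {ρ : Var → Dom C} where

    Models-reduct₁ : Models (T₁ ⊔ T₂) C ρ → Models T₁ (reduct₁ C) ρ
    Models-reduct₁ ⊨T ψ ax = Sat-inlF⁻ C ψ ρ (⊨T (inlF ψ) (inj₁ (ψ , ax , refl)))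

    Models-reduct₂ : Models (T₁ ⊔ T₂) C ρ → Models T₂ (reduct₂ C) ρ
    Models-reduct₂ ⊨T ψ ax = Sat-inrF⁻ C ψ ρ (⊨T (inrF ψ) (inj₂ (ψ , ax , refl)))

    Models-⊔ : Models T₁ (reduct₁ C) ρ → Models T₂ (reduct₂ C) ρ → Models (T₁ ⊔ T₂) C ρ
    Models-⊔ ⊨T₁ ⊨T₂ .(inlF ψ) (inj₁ (ψ , ax , refl)) = Sat-inlF⁺ C ψ ρ (⊨T₁ ψ ax)
    Models-⊔ ⊨T₁ ⊨T₂ .(inrF ψ) (inj₂ (ψ , ax , refl)) = Sat-inrF⁺ C ψ ρ (⊨T₂ ψ ax)

↔-injective : ∀ {A B : Set} (h : A ↔ B) {a a'} → Inverse.to h a ≡ Inverse.to h a' → a ≡ a'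
↔-injective h = Injection.injective (Inverse⇒Injection h)

SamePattern : {A B : Set} → (ℕ → A) → (ℕ → B) → ℕ → Set
SamePattern as bs N = ∀ {i j} → i < N → j < N → as i ≡ as j ⇔ bs i ≡ bs j

module _ {n : ℕ} where

  transpose-here : ∀ (c b : Fin n) → PC.transpose c b c ≡ b
  transpose-here c b rewrite dec-true (c ≟F c) refl = refl

  transpose-fixes : ∀ {c b z : Fin n} → z ≡ c ⇔ z ≡ b → PC.transpose c b z ≡ z
  transpose-fixes {c} {b} {z} z≡c⇔z≡b with z ≟F c
  ... | yes refl = sym (Equivalence.to z≡c⇔z≡b refl)
  ... | no z≢c with z ≟F b
  ...   | yes z≡b = ⊥-elim (z≢c (Equivalence.from z≡c⇔z≡b z≡b))
  ...   | no _ = refl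

  -- Induction on N: once as 0..N-1 are mapped correctly, compose with the transposition
  -- sending the image of as N to bs N; the pattern hypothesis shows it fixes bs 0..N-1.
  extend-pattern : ∀ (as bs : ℕ → Fin n) N → SamePattern as bs N →
                   Σ (Permutation′ n) λ π → ∀ {i} → i < N → π ⟨$⟩ʳ as i ≡ bs i
  extend-pattern as bs zero _ = idₚ , λ ()
  extend-pattern as bs (suc N) same with extend-pattern as bs N (λ i<N j<N → same (m≤n⇒m≤1+n i<N) (m≤n⇒m≤1+n j<N))
  ... | σ , σ-ok = σ ∘ₚ transpose c (bs N) , ok
    where
    c = σ ⟨$⟩ʳ as N
    ok : ∀ {i} → i < suc N → PC.transpose c (bs N) (σ ⟨$⟩ʳ as i) ≡ bs i
    ok {i} i<1+N with i ≟ℕ N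
    ... | yes refl = transpose-here c (bs N)
    ... | no i≢N with ≤∧≢⇒< (m<1+n⇒m≤n i<1+N) i≢N
    ...   | i<N = trans (cong (PC.transpose c (bs N)) (σ-ok i<N)) (transpose-fixes (mk⇔ to from))
      where
      same-iN = same (m≤n⇒m≤1+n i<N) (n<1+n N)
      to : bs i ≡ c → bs i ≡ bs N
      to bsi≡c = Equivalence.to same-iN (↔-injective σ (trans (σ-ok i<N) bsi≡c))
      from : bs i ≡ bs N → bs i ≡ c
      from bsi≡bsN = trans (sym (σ-ok i<N)) (cong (σ ⟨$⟩ʳ_) (Equivalence.from same-iN bsi≡bsN))

module _ {Σ₁ Σ₂ : Signature} (T₁ : Theory Σ₁) (T₂ : Theory Σ₂) (cl : Classical) where

  -- M₂ is transported along h to the domain of M₁, and the two are glued.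
  amalgamate : ∀ ψ₁ ψ₂ (M₁ : Structure Σ₁) ρ₁ (M₂ : Structure Σ₂) ρ₂ (h : Dom M₁ ↔ Dom M₂) →
               Models T₁ M₁ ρ₁ → Sat M₁ ρ₁ ψ₁ → Models T₂ M₂ ρ₂ → Sat M₂ ρ₂ ψ₂ →
               (∀ x → FreeIn x ψ₂ → Inverse.to h (ρ₁ x) ≡ ρ₂ x) →
               HasModel (T₁ ⊔ T₂) (inlF ψ₁ ∧' inrF ψ₂)
  amalgamate ψ₁ ψ₂ M₁ ρ₁ M₂ ρ₂ h ⊨T₁ sat₁ ⊨T₂ sat₂ h∘ρ₁≡ρ₂ =
    C , ρ₁ , tt , Models-⊔ T₁ T₂ C ⊨T₁ ⊨T₂' , Sat-inlF⁺ C ψ₁ ρ₁ sat₁ , Sat-inrF⁺ C ψ₂ ρ₁ sat₂'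
    where
    open Inverse h
    open TarskiVaught cl M₂ (inhab M₁) to from (↔-injective h) (λ _ _ → strictlyInverseˡ _)
      (λ ψ σ x d sat → from d , subst (λ d' → Sat M₂ (update M₂ (to ∘ σ) x d') ψ) (sym (strictlyInverseˡ d)) sat)
    C : Structure (Σ₁ ⊕ Σ₂)
    C = record
      { Dom = Dom M₁ ; inhab = inhab M₁
      ; funI = λ { (inj₁ f) → funI M₁ f ; (inj₂ f) → funI induced f }
      ; predI = λ { (inj₁ p) → predI M₁ p ; (inj₂ p) → predI induced p } }
    ⊨T₂' : Models T₂ induced ρ₁
    ⊨T₂' ψ ax = reflects ψ ρ₁ (Models-reassign M₂ {T₂} ⊨T₂ ψ ax)
    sat₂' : Sat induced ρ₁ ψ₂
    sat₂' = reflects ψ₂ ρ₁ (Sat-agree M₂ ψ₂ (λ x x∈ψ₂ → sym (h∘ρ₁≡ρ₂ x x∈ψ₂)) sat₂)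

  amalgamate-finite : ∀ ψ₁ ψ₂ {N n} → (∀ x → FreeIn x ψ₂ → x < N) →
    (s₁ : SatIn T₁ (HasCard (fin n)) ψ₁) (s₂ : SatIn T₂ (HasCard (fin n)) ψ₂) →
    SamePattern (proj₁ (proj₂ s₁)) (proj₁ (proj₂ s₂)) N →
    HasModel (T₁ ⊔ T₂) (inlF ψ₁ ∧' inrF ψ₂)
  amalgamate-finite ψ₁ ψ₂ {N} ψ₂<N (M₁ , ρ₁ , i₁ , ⊨T₁ , sat₁) (M₂ , ρ₂ , i₂ , ⊨T₂ , sat₂) same =
    amalgamate ψ₁ ψ₂ M₁ ρ₁ M₂ ρ₂ h ⊨T₁ sat₁ ⊨T₂ sat₂ h∘ρ₁≡ρ₂
    where
    same' : SamePattern (Inverse.to i₁ ∘ ρ₁) (Inverse.to i₂ ∘ ρ₂) N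
    same' i<N j<N = mk⇔ (cong (Inverse.to i₂) ∘ Equivalence.to (same i<N j<N) ∘ ↔-injective i₁)
                        (cong (Inverse.to i₁) ∘ Equivalence.from (same i<N j<N) ∘ ↔-injective i₂)
    π = extend-pattern (Inverse.to i₁ ∘ ρ₁) (Inverse.to i₂ ∘ ρ₂) N same'
    h : Dom M₁ ↔ Dom M₂
    h = ↔-sym i₂ ↔-∘ (proj₁ π ↔-∘ i₁)
    h∘ρ₁≡ρ₂ : ∀ x → FreeIn x ψ₂ → Inverse.to h (ρ₁ x) ≡ ρ₂ x
    h∘ρ₁≡ρ₂ x x∈ψ₂ =
      trans (cong (Inverse.from i₂) (proj₂ π (ψ₂<N x x∈ψ₂))) (Inverse.strictlyInverseʳ i₂ (ρ₂ x))

-- Literals, normal forms and arrangements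

Signed : Bool → Set → Set
Signed true A = A
Signed false A = ¬ A

module _ {Σ' : Signature} where

  data Atom : Set where
    _≐ₐ_ : Term Σ' → Term Σ' → Atom
    relₐ : (p : PredSym Σ') → Vec (Term Σ') (predAr Σ' p) → Atom

  Lit : Set
  Lit = Bool × Atom

  atomF : Atom → Formula Σ'
  atomF (s ≐ₐ t) = s ≐ t
  atomF (relₐ p ts) = rel p ts

  litF : Lit → Formula Σ'
  litF (true , a) = atomF a
  litF (false , a) = ¬' atomF a

  Holds : (M : Structure Σ') → (Var → Dom M) → Lit → Set
  Holds M ρ (b , a) = Signed b (Sat M ρ (atomF a))

  -- the empty conjunction needs a variable, as there may be no constants
  conj : List Lit → Formula Σ'
  conj [] = var 0 ≐ var 0
  conj (l ∷ ls) = litF l ∧' conj ls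

  conj-qf : ∀ ls → IsQF (conj ls)
  conj-qf [] = qf-≐
  conj-qf ((true , s ≐ₐ t) ∷ ls) = qf-∧ qf-≐ (conj-qf ls)
  conj-qf ((true , relₐ p ts) ∷ ls) = qf-∧ qf-rel (conj-qf ls)
  conj-qf ((false , s ≐ₐ t) ∷ ls) = qf-∧ (qf-¬ qf-≐) (conj-qf ls)
  conj-qf ((false , relₐ p ts) ∷ ls) = qf-∧ (qf-¬ qf-rel) (conj-qf ls)

  module _ (M : Structure Σ') (ρ : Var → Dom M) where

    Sat-conj⁺ : ∀ {ls} → All (Holds M ρ) ls → Sat M ρ (conj ls)
    Sat-conj⁺ [] = refl
    Sat-conj⁺ {(true , _) ∷ _} (h ∷ hs) = h , Sat-conj⁺ hs
    Sat-conj⁺ {(false , _) ∷ _} (h ∷ hs) = h , Sat-conj⁺ hs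

    Sat-conj⁻ : ∀ ls → Sat M ρ (conj ls) → All (Holds M ρ) ls
    Sat-conj⁻ [] _ = []
    Sat-conj⁻ ((true , _) ∷ ls) (h , hs) = h ∷ Sat-conj⁻ ls hs
    Sat-conj⁻ ((false , _) ∷ ls) (h , hs) = h ∷ Sat-conj⁻ ls hs

  conj-free : ∀ {x} ls → FreeIn x (conj ls) → x ≡ 0 ⊎ Any (FreeIn x ∘ litF) ls
  conj-free [] = [ inj₁ , inj₁ ]′
  conj-free (l ∷ ls) = [ inj₂ ∘ here , [ inj₁ , inj₂ ∘ there ]′ ∘ conj-free ls ]′

  _⊗_ : List (List Lit) → List (List Lit) → List (List Lit)
  _⊗_ = cartesianProductWith _++_

  -- dnf φ true is a disjunctive normal form of φ, and dnf φ false one of ¬ φ.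
  dnf : Formula Σ' → Bool → List (List Lit)
  dnf (s ≐ t) b = [ [ b , s ≐ₐ t ] ]
  dnf (rel p ts) b = [ [ b , relₐ p ts ] ]
  dnf (¬' φ) b = dnf φ (not b)
  dnf (φ ∧' ψ) true = dnf φ true ⊗ dnf ψ true
  dnf (φ ∧' ψ) false = dnf φ false ++ dnf ψ false
  dnf (φ ∨' ψ) true = dnf φ true ++ dnf ψ true
  dnf (φ ∨' ψ) false = dnf φ false ⊗ dnf ψ false
  dnf (φ ⇒' ψ) true = dnf φ false ++ dnf ψ true
  dnf (φ ⇒' ψ) false = dnf φ true ⊗ dnf ψ false
  dnf (∀' x φ) b = []
  dnf (∃' x φ) b = []

  module _ (M : Structure Σ') (ρ : Var → Dom M) where

    private
      Disjunct = All (Holds M ρ)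

      ⊗⁺ : ∀ {Cs Ds} → Any Disjunct Cs → Any Disjunct Ds → Any Disjunct (Cs ⊗ Ds)
      ⊗⁺ = Any.cartesianProductWith⁺ _++_ All.++⁺

      ⊗⁻ : ∀ Cs Ds → Any Disjunct (Cs ⊗ Ds) → Any Disjunct Cs × Any Disjunct Ds
      ⊗⁻ = Any.cartesianProductWith⁻ _++_ (λ {C} → All.++⁻ C)

    dnf-sound : ∀ φ b → Any Disjunct (dnf φ b) → Signed b (Sat M ρ φ)
    dnf-sound (s ≐ t) b (here (h ∷ [])) = h
    dnf-sound (rel p ts) b (here (h ∷ [])) = h
    dnf-sound (¬' φ) true d = dnf-sound φ false d
    dnf-sound (¬' φ) false d ¬φ = ¬φ (dnf-sound φ true d)
    dnf-sound (φ ∧' ψ) true d with ⊗⁻ (dnf φ true) _ d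
    ... | dφ , dψ = dnf-sound φ true dφ , dnf-sound ψ true dψ
    dnf-sound (φ ∧' ψ) false d with Any.++⁻ (dnf φ false) d
    ... | inj₁ dφ = dnf-sound φ false dφ ∘ proj₁
    ... | inj₂ dψ = dnf-sound ψ false dψ ∘ proj₂
    dnf-sound (φ ∨' ψ) true d with Any.++⁻ (dnf φ true) d
    ... | inj₁ dφ = inj₁ (dnf-sound φ true dφ)
    ... | inj₂ dψ = inj₂ (dnf-sound ψ true dψ)
    dnf-sound (φ ∨' ψ) false d with ⊗⁻ (dnf φ false) _ d
    ... | dφ , dψ = [ dnf-sound φ false dφ , dnf-sound ψ false dψ ]′
    dnf-sound (φ ⇒' ψ) true d with Any.++⁻ (dnf φ false) d
    ... | inj₁ dφ = ⊥-elim ∘ dnf-sound φ false dφ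
    ... | inj₂ dψ = λ _ → dnf-sound ψ true dψ
    dnf-sound (φ ⇒' ψ) false d with ⊗⁻ (dnf φ true) _ d
    ... | dφ , dψ = λ f → dnf-sound ψ false dψ (f (dnf-sound φ true dφ))

    dnf-complete : Classical → ∀ φ → IsQF φ → ∀ b → Signed b (Sat M ρ φ) → Any Disjunct (dnf φ b)
    dnf-complete cl (s ≐ t) _ b h = here (h ∷ [])
    dnf-complete cl (rel p ts) _ b h = here (h ∷ [])
    dnf-complete cl (¬' φ) (qf-¬ q) true h = dnf-complete cl φ q false h
    dnf-complete cl (¬' φ) (qf-¬ q) false h with classical-Dec cl (Sat M ρ φ)
    ... | yes s = dnf-complete cl φ q true s
    ... | no ¬s = ⊥-elim (h ¬s)
    dnf-complete cl (φ ∧' ψ) (qf-∧ qφ qψ) true (sφ , sψ) =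
      ⊗⁺ (dnf-complete cl φ qφ true sφ) (dnf-complete cl ψ qψ true sψ)
    dnf-complete cl (φ ∧' ψ) (qf-∧ qφ qψ) false h with classical-Dec cl (Sat M ρ φ)
    ... | no ¬sφ = Any.++⁺ˡ (dnf-complete cl φ qφ false ¬sφ)
    ... | yes sφ = Any.++⁺ʳ (dnf φ false) (dnf-complete cl ψ qψ false (h ∘ (sφ ,_)))
    dnf-complete cl (φ ∨' ψ) (qf-∨ qφ qψ) true (inj₁ sφ) = Any.++⁺ˡ (dnf-complete cl φ qφ true sφ)
    dnf-complete cl (φ ∨' ψ) (qf-∨ qφ qψ) true (inj₂ sψ) = Any.++⁺ʳ (dnf φ true) (dnf-complete cl ψ qψ true sψ)
    dnf-complete cl (φ ∨' ψ) (qf-∨ qφ qψ) false h =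
      ⊗⁺ (dnf-complete cl φ qφ false (h ∘ inj₁)) (dnf-complete cl ψ qψ false (h ∘ inj₂))
    dnf-complete cl (φ ⇒' ψ) (qf-⇒ qφ qψ) true h with classical-Dec cl (Sat M ρ φ)
    ... | no ¬sφ = Any.++⁺ˡ (dnf-complete cl φ qφ false ¬sφ)
    ... | yes sφ = Any.++⁺ʳ (dnf φ false) (dnf-complete cl ψ qψ true (h sφ))
    dnf-complete cl (φ ⇒' ψ) (qf-⇒ qφ qψ) false h with classical-Dec cl (Sat M ρ φ)
    ... | no ¬sφ = ⊥-elim (h (⊥-elim ∘ ¬sφ))
    ... | yes sφ = ⊗⁺ (dnf-complete cl φ qφ true sφ) (dnf-complete cl ψ qψ false (h ∘ λ sψ _ → sψ))

Signed-does⁺ : ∀ {P Q : Set} (Q? : Dec Q) → P ⇔ Q → Signed (does Q?) P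
Signed-does⁺ (yes q) P⇔Q = Equivalence.from P⇔Q q
Signed-does⁺ (no ¬q) P⇔Q = ¬q ∘ Equivalence.to P⇔Q

Signed-does⁻ : ∀ {P Q : Set} (Q? : Dec Q) → Signed (does Q?) P → P ⇔ Q
Signed-does⁻ (yes q) p = mk⇔ (λ _ → q) (λ _ → p)
Signed-does⁻ (no ¬q) ¬p = mk⇔ (⊥-elim ∘ ¬p) (⊥-elim ∘ ¬q)

-- A coloring a of the variables 0, ..., N-1 lists their colors; past its end every
-- variable has color 0.
at : List ℕ → ℕ → ℕ
at [] _ = 0
at (c ∷ a) zero = c
at (c ∷ a) (suc i) = at a i

at-applyUpTo : ∀ (f : ℕ → ℕ) {n i} → i < n → at (applyUpTo f n) i ≡ f i
at-applyUpTo f {suc n} {zero} _ = refl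
at-applyUpTo f {suc n} {suc i} (s≤s i<n) = at-applyUpTo (f ∘ suc) i<n

colorings : ℕ → ℕ → List (List ℕ)
colorings zero K = [ [] ]
colorings (suc n) K = cartesianProductWith _∷_ (upTo K) (colorings n K)

applyUpTo∈colorings : ∀ (f : ℕ → ℕ) n {K} → (∀ {i} → i < n → f i < K) → applyUpTo f n ∈ colorings n K
applyUpTo∈colorings f zero _ = here refl
applyUpTo∈colorings f (suc n) f<K =
  Any.cartesianProductWith⁺ _∷_ {P = f 0 ≡_} {Q = applyUpTo (f ∘ suc) n ≡_} (λ { refl refl → refl })
    (Any.applyUpTo⁺ id refl (f<K (s≤s z≤n))) (applyUpTo∈colorings (f ∘ suc) n (f<K ∘ s≤s))

Injective≤ : {D : Set} → (ℕ → D) → ℕ → Set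
Injective≤ g m = ∀ {i j} → i < j → j < suc m → g i ≢ g j

module _ {Σ' : Signature} where

  colorLit : List ℕ → ℕ → ℕ → Lit {Σ'}
  colorLit a i j = does (at a i ≟ℕ at a j) , var i ≐ₐ var j

  arrangement : List ℕ → ℕ → List (Lit {Σ'})
  arrangement a N = concat (applyUpTo (λ i → applyUpTo (colorLit a i) N) N)

  module _ (M : Structure Σ') (ρ : Var → Dom M) where

    arrangement⁺ : ∀ a N → SamePattern ρ (at a) N → All (Holds M ρ) (arrangement a N)
    arrangement⁺ a N same = All.concat⁺ (All.applyUpTo⁺₁ _ N λ i<N →
      All.applyUpTo⁺₁ _ N λ j<N → Signed-does⁺ (at a _ ≟ℕ at a _) (same i<N j<N))

    arrangement⁻ : ∀ a N → All (Holds M ρ) (arrangement a N) → SamePattern ρ (at a) N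
    arrangement⁻ a N hs i<N j<N =
      Signed-does⁻ (at a _ ≟ℕ at a _) (All.applyUpTo⁻ _ N (All.applyUpTo⁻ _ N (All.concat⁻ hs) i<N) j<N)

  litF-vars-free : ∀ b {x i j} → FreeIn x (litF (b , var {Σ'} i ≐ₐ var j)) → x ≡ i ⊎ x ≡ j
  litF-vars-free true = id
  litF-vars-free false = id

  arrangement-free : ∀ {x} a n → FreeIn x (conj (arrangement a (suc n))) → x < suc n
  arrangement-free {x} a n x∈ with conj-free (arrangement a (suc n)) x∈
  ... | inj₁ refl = s≤s z≤n
  ... | inj₂ x∈lits with Any.applyUpTo⁻ (λ i → applyUpTo (colorLit a i) (suc n)) (Any.concat⁻ _ x∈lits)
  ...   | i , i<N , x∈row with Any.applyUpTo⁻ (colorLit a i) x∈row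
  ...     | j , j<N , x∈lit with litF-vars-free (does (at a i ≟ℕ at a j)) {x} {i} {j} x∈lit
  ...       | inj₁ refl = i<N
  ...       | inj₂ refl = j<N

  distinctFrom : ℕ → ℕ → List (Lit {Σ'})
  distinctFrom N j = applyUpTo (λ i → false , var (N + i) ≐ₐ var (N + j)) j

  distinct : ℕ → ℕ → List (Lit {Σ'})
  distinct N m = concat (applyUpTo (distinctFrom N) (suc m))

  module _ (M : Structure Σ') (ρ : Var → Dom M) where

    distinct⁺ : ∀ {N m} → Injective≤ (ρ ∘ (N +_)) m → All (Holds M ρ) (distinct N m)
    distinct⁺ {N} {m} injective = All.concat⁺ (All.applyUpTo⁺₁ (distinctFrom N) (suc m) λ {j} j<1+m →
      All.applyUpTo⁺₁ (λ i → false , var (N + i) ≐ₐ var (N + j)) j λ i<j → injective i<j j<1+m)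

    distinct⁻ : ∀ {N m} → All (Holds M ρ) (distinct N m) → Injective≤ (ρ ∘ (N +_)) m
    distinct⁻ {N} {m} hs {i} {j} i<j j<1+m =
      All.applyUpTo⁻ (λ i → false , var (N + i) ≐ₐ var (N + j)) j
        (All.applyUpTo⁻ (distinctFrom N) (suc m) (All.concat⁻ hs) j<1+m) i<j

  withDistinct : QF Σ' → ℕ → ℕ → QF Σ'
  withDistinct (q , q-qf) N m = q ∧' conj (distinct N m) , qf-∧ q-qf (conj-qf _)

-- Purification and candidates

-- Every term t of the combined signature is named by the variable codeT t (so x is renamed
-- codeT (var x)). A literal is split into a Σ₁-part and a Σ₂-part by naming all its
-- subterms and recording, on the side of each head symbol, how the name of an application
-- is computed from the names of its arguments.
module Purification {Σ₁ Σ₂ : Signature} where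
  open Coding (Σ₁ ⊕ Σ₂) using (codeT; codeT-injective)

  names : ∀ {Σ' n} → Vec (Term (Σ₁ ⊕ Σ₂)) n → Vec (Term Σ') n
  names = Vec.map (var ∘ codeT)

  evalV-names : ∀ {Σ'} (N : Structure Σ') ρ {n} (ts : Vec _ n) → evalV N ρ (names ts) ≡ Vec.map (ρ ∘ codeT) ts
  evalV-names N ρ = evalV-map N ρ (var ∘ codeT)

  mutual
    defs₁ : Term (Σ₁ ⊕ Σ₂) → List (Lit {Σ₁})
    defs₁ (var x) = []
    defs₁ t@(app (inj₁ f) ts) = (true , var (codeT t) ≐ₐ app f (names ts)) ∷ defsV₁ ts
    defs₁ (app (inj₂ f) ts) = defsV₁ ts

    defsV₁ : ∀ {n} → Vec (Term (Σ₁ ⊕ Σ₂)) n → List (Lit {Σ₁})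
    defsV₁ [] = []
    defsV₁ (t ∷ ts) = defs₁ t ++ defsV₁ ts

  mutual
    defs₂ : Term (Σ₁ ⊕ Σ₂) → List (Lit {Σ₂})
    defs₂ (var x) = []
    defs₂ (app (inj₁ f) ts) = defsV₂ ts
    defs₂ t@(app (inj₂ f) ts) = (true , var (codeT t) ≐ₐ app f (names ts)) ∷ defsV₂ ts

    defsV₂ : ∀ {n} → Vec (Term (Σ₁ ⊕ Σ₂)) n → List (Lit {Σ₂})
    defsV₂ [] = []
    defsV₂ (t ∷ ts) = defs₂ t ++ defsV₂ ts

  purify₁ : Lit {Σ₁ ⊕ Σ₂} → List (Lit {Σ₁})
  purify₁ (b , s ≐ₐ t) = (b , var (codeT s) ≐ₐ var (codeT t)) ∷ defs₁ s ++ defs₁ t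
  purify₁ (b , relₐ (inj₁ p) ts) = (b , relₐ p (names ts)) ∷ defsV₁ ts
  purify₁ (b , relₐ (inj₂ p) ts) = defsV₁ ts

  purify₂ : Lit {Σ₁ ⊕ Σ₂} → List (Lit {Σ₂})
  purify₂ (b , s ≐ₐ t) = defs₂ s ++ defs₂ t
  purify₂ (b , relₐ (inj₁ p) ts) = defsV₂ ts
  purify₂ (b , relₐ (inj₂ p) ts) = (b , relₐ p (names ts)) ∷ defsV₂ ts

  pure₁ : List (Lit {Σ₁ ⊕ Σ₂}) → List (Lit {Σ₁})
  pure₁ = concatMap purify₁

  pure₂ : List (Lit {Σ₁ ⊕ Σ₂}) → List (Lit {Σ₂})
  pure₂ = concatMap purify₂

  module _ (M : Structure (Σ₁ ⊕ Σ₂)) (ρ ρ₀ : Var → Dom M) where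

    private
      M₁ = reduct₁ M
      M₂ = reduct₂ M

    Names : Term (Σ₁ ⊕ Σ₂) → Set
    Names t = ρ (codeT t) ≡ evalT M ρ₀ t

    NamesV : ∀ {n} → Vec (Term (Σ₁ ⊕ Σ₂)) n → Set
    NamesV ts = Vec.map (ρ ∘ codeT) ts ≡ evalV M ρ₀ ts

    module _ (names-vars : ∀ x → Names (var x)) where
      mutual
        defs-Names : ∀ t → All (Holds M₁ ρ) (defs₁ t) → All (Holds M₂ ρ) (defs₂ t) → Names t
        defs-Names (var x) _ _ = names-vars x
        defs-Names (app (inj₁ f) ts) (def ∷ h₁) h₂ =
          trans def (cong (funI M (inj₁ f)) (trans (evalV-names M₁ ρ ts) (defsV-NamesV ts h₁ h₂)))
        defs-Names (app (inj₂ f) ts) h₁ (def ∷ h₂) =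
          trans def (cong (funI M (inj₂ f)) (trans (evalV-names M₂ ρ ts) (defsV-NamesV ts h₁ h₂)))

        defsV-NamesV : ∀ {n} (ts : Vec _ n) → All (Holds M₁ ρ) (defsV₁ ts) → All (Holds M₂ ρ) (defsV₂ ts) → NamesV ts
        defsV-NamesV [] _ _ = refl
        defsV-NamesV (t ∷ ts) h₁ h₂ with All.++⁻ (defs₁ t) h₁ | All.++⁻ (defs₂ t) h₂
        ... | ht₁ , hts₁ | ht₂ , hts₂ = cong₂ _∷_ (defs-Names t ht₁ ht₂) (defsV-NamesV ts hts₁ hts₂)

      purify-sound : ∀ l → All (Holds M₁ ρ) (purify₁ l) → All (Holds M₂ ρ) (purify₂ l) → Holds M ρ₀ l
      purify-sound (b , s ≐ₐ t) (h ∷ h₁) h₂ with All.++⁻ (defs₁ s) h₁ | All.++⁻ (defs₂ s) h₂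
      ... | hs₁ , ht₁ | hs₂ , ht₂ = subst (Signed b) (cong₂ _≡_ (defs-Names s hs₁ hs₂) (defs-Names t ht₁ ht₂)) h
      purify-sound (b , relₐ (inj₁ p) ts) (h ∷ h₁) h₂ =
        subst (Signed b) (cong (predI M (inj₁ p)) (trans (evalV-names M₁ ρ ts) (defsV-NamesV ts h₁ h₂))) h
      purify-sound (b , relₐ (inj₂ p) ts) h₁ (h ∷ h₂) =
        subst (Signed b) (cong (predI M (inj₂ p)) (trans (evalV-names M₂ ρ ts) (defsV-NamesV ts h₁ h₂))) h

      pure-sound : ∀ C → All (Holds M₁ ρ) (pure₁ C) → All (Holds M₂ ρ) (pure₂ C) → All (Holds M ρ₀) C
      pure-sound [] _ _ = []
      pure-sound (l ∷ C) h₁ h₂ with All.++⁻ (purify₁ l) h₁ | All.++⁻ (purify₂ l) h₂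
      ... | hl₁ , hC₁ | hl₂ , hC₂ = purify-sound l hl₁ hl₂ ∷ pure-sound C hC₁ hC₂

    module _ (names-all : ∀ t → Names t) where
      namesV-all : ∀ {n} (ts : Vec _ n) → NamesV ts
      namesV-all [] = refl
      namesV-all (t ∷ ts) = cong₂ _∷_ (names-all t) (namesV-all ts)

      mutual
        defs₁-hold : ∀ t → All (Holds M₁ ρ) (defs₁ t)
        defs₁-hold (var x) = []
        defs₁-hold t@(app (inj₁ f) ts) =
          trans (names-all t) (cong (funI M (inj₁ f)) (sym (trans (evalV-names M₁ ρ ts) (namesV-all ts))))
          ∷ defsV₁-hold ts
        defs₁-hold (app (inj₂ f) ts) = defsV₁-hold ts

        defsV₁-hold : ∀ {n} (ts : Vec _ n) → All (Holds M₁ ρ) (defsV₁ ts)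
        defsV₁-hold [] = []
        defsV₁-hold (t ∷ ts) = All.++⁺ (defs₁-hold t) (defsV₁-hold ts)

      mutual
        defs₂-hold : ∀ t → All (Holds M₂ ρ) (defs₂ t)
        defs₂-hold (var x) = []
        defs₂-hold (app (inj₁ f) ts) = defsV₂-hold ts
        defs₂-hold t@(app (inj₂ f) ts) =
          trans (names-all t) (cong (funI M (inj₂ f)) (sym (trans (evalV-names M₂ ρ ts) (namesV-all ts))))
          ∷ defsV₂-hold ts

        defsV₂-hold : ∀ {n} (ts : Vec _ n) → All (Holds M₂ ρ) (defsV₂ ts)
        defsV₂-hold [] = []
        defsV₂-hold (t ∷ ts) = All.++⁺ (defs₂-hold t) (defsV₂-hold ts)

      purify₁-complete : ∀ l → Holds M ρ₀ l → All (Holds M₁ ρ) (purify₁ l)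
      purify₁-complete (b , s ≐ₐ t) h =
        subst (Signed b) (sym (cong₂ _≡_ (names-all s) (names-all t))) h ∷ All.++⁺ (defs₁-hold s) (defs₁-hold t)
      purify₁-complete (b , relₐ (inj₁ p) ts) h =
        subst (Signed b) (cong (predI M (inj₁ p)) (sym (trans (evalV-names M₁ ρ ts) (namesV-all ts)))) h
        ∷ defsV₁-hold ts
      purify₁-complete (b , relₐ (inj₂ p) ts) h = defsV₁-hold ts

      purify₂-complete : ∀ l → Holds M ρ₀ l → All (Holds M₂ ρ) (purify₂ l)
      purify₂-complete (b , s ≐ₐ t) h = All.++⁺ (defs₂-hold s) (defs₂-hold t)
      purify₂-complete (b , relₐ (inj₁ p) ts) h = defsV₂-hold ts
      purify₂-complete (b , relₐ (inj₂ p) ts) h =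
        subst (Signed b) (cong (predI M (inj₂ p)) (sym (trans (evalV-names M₂ ρ ts) (namesV-all ts)))) h
        ∷ defsV₂-hold ts

      pure₁-complete : ∀ {C} → All (Holds M ρ₀) C → All (Holds M₁ ρ) (pure₁ C)
      pure₁-complete [] = []
      pure₁-complete {l ∷ _} (h ∷ hs) = All.++⁺ (purify₁-complete l h) (pure₁-complete hs)

      pure₂-complete : ∀ {C} → All (Holds M ρ₀) C → All (Holds M₂ ρ) (pure₂ C)
      pure₂-complete [] = []
      pure₂-complete {l ∷ _} (h ∷ hs) = All.++⁺ (purify₂-complete l h) (pure₂-complete hs)

  naming : Classical → (M : Structure (Σ₁ ⊕ Σ₂)) → (Var → Dom M) → Var → Dom M
  naming cl M ρ₀ y with classical-Dec cl (Σ (Term (Σ₁ ⊕ Σ₂)) λ t → codeT t ≡ y)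
  ... | yes (t , _) = evalT M ρ₀ t
  ... | no _ = inhab M

  naming-Names : ∀ cl M ρ₀ t → Names M (naming cl M ρ₀) ρ₀ t
  naming-Names cl M ρ₀ t with classical-Dec cl (Σ (Term (Σ₁ ⊕ Σ₂)) λ t' → codeT t' ≡ codeT t)
  ... | yes (t' , eq) = cong (evalT M ρ₀) (codeT-injective {t'} {t} eq)
  ... | no none = ⊥-elim (none (t , refl))

-- A candidate is a pair of pure formulas that agree on the arrangement of their shared
-- variables 0, ..., width - 1.
record Candidate (Σ₁ Σ₂ : Signature) : Set where
  field
    left : QF Σ₁
    right : QF Σ₂
    width : ℕ
    left-bounded : ∀ x → FreeIn x (proj₁ left) → x < width
    right-bounded : ∀ x → FreeIn x (proj₁ right) → x < width

open Candidate public

module _ {Σ₁ Σ₂ : Signature} where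
  open Purification {Σ₁} {Σ₂}

  widthOf : List (Lit {Σ₁ ⊕ Σ₂}) → ℕ
  widthOf C = suc (fvBound (conj (pure₁ C)) ⊔ₙ fvBound (conj (pure₂ C)))

  candidate : List (Lit {Σ₁ ⊕ Σ₂}) → List ℕ → Candidate Σ₁ Σ₂
  candidate C a = record
    { left = conj (pure₁ C) ∧' conj (arrangement a N) , qf-∧ (conj-qf (pure₁ C)) (conj-qf (arrangement a N))
    ; right = conj (pure₂ C) ∧' conj (arrangement a N) , qf-∧ (conj-qf (pure₂ C)) (conj-qf (arrangement a N))
    ; width = N
    ; left-bounded = λ { x (inj₁ x∈) → m≤n⇒m≤1+n (m<n⇒m<n⊔o _ (free<fvBound (conj (pure₁ C)) x∈))
                       ; x (inj₂ x∈) → arrangement-free a _ x∈ }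
    ; right-bounded = λ { x (inj₁ x∈) → m≤n⇒m≤1+n (m<n⇒m<o⊔n _ (free<fvBound (conj (pure₂ C)) x∈))
                        ; x (inj₂ x∈) → arrangement-free a _ x∈ }
    }
    where N = widthOf C

  candidatesFor : List (Lit {Σ₁ ⊕ Σ₂}) → List (Candidate Σ₁ Σ₂)
  candidatesFor C = map (candidate C) (colorings (widthOf C) (widthOf C))

  candidatesFor⁻ : ∀ {P : Candidate Σ₁ Σ₂ → Set} C → Any P (candidatesFor C) → Σ (List ℕ) (P ∘ candidate C)
  candidatesFor⁻ C = Any.satisfied ∘ Any.map⁻ {f = candidate C} {xs = colorings (widthOf C) (widthOf C)}

  candidates : Formula (Σ₁ ⊕ Σ₂) → List (Candidate Σ₁ Σ₂)
  candidates φ = concatMap candidatesFor (dnf φ true)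

  module _ (T₁ : Theory Σ₁) (T₂ : Theory Σ₂) (cl : Classical) where
    open Coding (Σ₁ ⊕ Σ₂) using (codeT)

    ModelOf : List (Lit {Σ₁ ⊕ Σ₂}) → Set₁
    ModelOf C = Σ (Structure (Σ₁ ⊕ Σ₂)) λ M → Σ (Var → Dom M) λ ρ →
                  Models (T₁ ⊔ T₂) M ρ × All (Holds M ρ) C

    candidate-sound : ∀ C a {n} → InSpec T₁ (left (candidate C a)) (fin n) → InSpec T₂ (right (candidate C a)) (fin n) →
                      ModelOf C
    candidate-sound C a s₁@(M₁ , ρ₁ , _ , _ , _ , arranged₁) s₂@(M₂ , ρ₂ , _ , _ , _ , arranged₂) =
      model (amalgamate-finite T₁ T₂ cl ψ₁ ψ₂ (right-bounded c) s₁ s₂ same)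
      where
      c = candidate C a
      ψ₁ = proj₁ (left c)
      ψ₂ = proj₁ (right c)
      N = widthOf C
      same : SamePattern ρ₁ ρ₂ N
      same i<N j<N = ⇔-sym (arrangement⁻ M₂ ρ₂ a N (Sat-conj⁻ M₂ ρ₂ (arrangement a N) arranged₂) i<N j<N)
                     ⇔-∘ arrangement⁻ M₁ ρ₁ a N (Sat-conj⁻ M₁ ρ₁ (arrangement a N) arranged₁) i<N j<N
      model : HasModel (T₁ ⊔ T₂) (inlF ψ₁ ∧' inrF ψ₂) → ModelOf C
      model (M , ρ , _ , ⊨T , sat₁ , sat₂) =
        M , ρ ∘ codeT ∘ var , Models-reassign M {T₁ ⊔ T₂} ⊨T ,
        pure-sound M ρ _ (λ _ → refl) C (Sat-conj⁻ _ ρ _ (proj₁ (Sat-inlF⁻ M ψ₁ ρ sat₁)))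
                                        (Sat-conj⁻ _ ρ _ (proj₁ (Sat-inrF⁻ M ψ₂ ρ sat₂)))

  module _ (cl : Classical) (M : Structure (Σ₁ ⊕ Σ₂)) (ρ₀ : Var → Dom M) where
      private
        ρ* = naming cl M ρ₀
      open FirstOccurrence (λ d d' → classical-Dec cl (d ≡ d')) ρ*

      SatisfiedBy : Candidate Σ₁ Σ₂ → Set
      SatisfiedBy c = Sat (reduct₁ M) ρ* (proj₁ (left c)) × Sat (reduct₂ M) ρ* (proj₁ (right c))

      candidate-complete : ∀ C → All (Holds M ρ₀) C → Any SatisfiedBy (candidatesFor C)
      candidate-complete C hs = Any.map⁺ (lose (applyUpTo∈colorings first N (λ {i} → ≤-<-trans (first-≤ i))) sat)
        where
        N = widthOf C
        same : SamePattern ρ* (at (applyUpTo first N)) N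
        same {i} {j} i<N j<N = subst₂ (λ a b → ρ* i ≡ ρ* j ⇔ a ≡ b)
          (sym (at-applyUpTo first i<N)) (sym (at-applyUpTo first j<N))
          (mk⇔ first-cong (λ eq → trans (sym (f-first i)) (trans (cong ρ* eq) (f-first j))))
        sat : SatisfiedBy (candidate C (applyUpTo first N))
        sat = (Sat-conj⁺ _ ρ* (pure₁-complete M ρ* ρ₀ (naming-Names cl M ρ₀) hs) ,
               Sat-conj⁺ _ ρ* (arrangement⁺ _ ρ* (applyUpTo first N) N same)) ,
              (Sat-conj⁺ _ ρ* (pure₂-complete M ρ* ρ₀ (naming-Names cl M ρ₀) hs) ,
               Sat-conj⁺ _ ρ* (arrangement⁺ _ ρ* (applyUpTo first N) N same))

      candidates-complete : ∀ φ → IsQF φ → Sat M ρ₀ φ → Any SatisfiedBy (candidates φ)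
      candidates-complete φ qf sat =
        Any.concatMap⁺ candidatesFor (Any.map (λ {C} → candidate-complete C) (dnf-complete M ρ₀ cl φ qf true sat))

-- Algorithms with fuel

module _ {A : Set} (alg : Algorithm A) (a : A) where

  run : ℕ → Maybe Bool
  run zero = alg a 0
  run (suc k) with run k
  ... | just b = just b
  ... | nothing = alg a (suc k)

  run-+ : ∀ {k b} d → run k ≡ just b → run (d + k) ≡ just b
  run-+ zero eq = eq
  run-+ {k} (suc d) eq with run (d + k) | run-+ {k} d eq
  ... | just _ | refl = refl

  run-mono : ∀ {k k' b} → k ≤ k' → run k ≡ just b → run k' ≡ just b
  run-mono {k} {k'} {b} k≤k' eq = subst (λ n → run n ≡ just b) (m∸n+n≡m k≤k') (run-+ (k' ∸ k) eq)

  run-answer : ∀ k {b} → run k ≡ just b → ∃ λ j → alg a j ≡ just b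
  run-answer zero eq = 0 , eq
  run-answer (suc k) eq with run k in run-k
  ... | just _ = run-answer k (trans run-k eq)
  ... | nothing = suc k , eq

  run-halts : ∀ k → alg a k ≢ nothing → ∃ λ b → run k ≡ just b
  run-halts zero halted with alg a 0
  ... | just b = b , refl
  ... | nothing = ⊥-elim (halted refl)
  run-halts (suc k) halted with run k
  ... | just b = b , refl
  ... | nothing with alg a (suc k)
  ...   | just b = b , refl
  ...   | nothing = ⊥-elim (halted refl)

module Decider {A : Set} {alg : Algorithm A} {P : A → Set₁} (decides : Decides alg P) where

  halts : ∀ a → ∃ λ k → ∃ λ b → run alg a k ≡ just b
  halts a = proj₁ (proj₁ (decides a)) , run-halts alg a _ (proj₂ (proj₁ (decides a)))

  true⇒P : ∀ {a} k → run alg a k ≡ just true → P a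
  true⇒P {a} k eq with run-answer alg a k eq
  ... | j , eq' = Equivalence.to (proj₂ (decides a) j true eq') refl

  false⇒¬P : ∀ {a} k → run alg a k ≡ just false → ¬ P a
  false⇒¬P {a} k eq p with run-answer alg a k eq
  ... | j , eq' with Equivalence.from (proj₂ (decides a) j false eq') p
  ... | ()

  P⇒true : ∀ {a} → P a → ∃ λ k → run alg a k ≡ just true
  P⇒true {a} p with halts a
  ... | k , true , eq = k , eq
  ... | k , false , eq = ⊥-elim (false⇒¬P k eq p)

  ¬P⇒false : ∀ {a} → ¬ P a → ∃ λ k → run alg a k ≡ just false
  ¬P⇒false {a} ¬p with halts a
  ... | k , false , eq = k , eq
  ... | k , true , eq = ⊥-elim (¬p (true⇒P k eq))

-- Bounding model sizes

_▷[_]_ : {D : Set} → (Var → D) → ℕ → (ℕ → D) → Var → D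
(ρ ▷[ N ] g) y with y <? N
... | yes _ = ρ y
... | no _ = g (y ∸ N)

module _ {D : Set} (ρ : Var → D) (N : ℕ) (g : ℕ → D) where

  ▷-below : ∀ {y} → y < N → (ρ ▷[ N ] g) y ≡ ρ y
  ▷-below {y} y<N with y <? N
  ... | yes _ = refl
  ... | no y≮N = ⊥-elim (y≮N y<N)

  ▷-above : ∀ i → (ρ ▷[ N ] g) (N + i) ≡ g i
  ▷-above i with N + i <? N
  ... | yes N+i<N = ⊥-elim (m+n≮m N i N+i<N)
  ... | no _ = cong g (m+n∸m≡n N i)

small-or-injective : ∀ {D : Set} → D → ∀ c → HasCard c D → ∀ m →
                     (∃ λ i → i < m × c ≡ fin (suc i)) ⊎ (Σ (ℕ → D) λ g → Injective≤ g m)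
small-or-injective d ℵ₀ card m = inj₂ (Inverse.from card , λ i<j _ → <⇒≢ i<j ∘ ↔-injective (↔-sym card))
small-or-injective d (fin zero) card m with () ← Inverse.to card d
small-or-injective d (fin (suc c)) card m with suc c ≤? m
... | yes 1+c≤m = inj₁ (c , 1+c≤m , refl)
... | no 1+c≰m = inj₂ (Inverse.from card ∘ (_mod suc c) , injective)
  where
  toℕ-mod : ∀ {i} → i < suc c → toℕ (i mod suc c) ≡ i
  toℕ-mod i<1+c = trans (toℕ-fromℕ< _) (m<n⇒m%n≡m i<1+c)
  injective : Injective≤ (Inverse.from card ∘ (_mod suc c)) m
  injective {i} {j} i<j j<1+m eq =
    <⇒≢ i<j (trans (sym (toℕ-mod i<1+c)) (trans (cong toℕ (↔-injective (↔-sym card) eq)) (toℕ-mod j<1+c)))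
    where
    j<1+c = <-≤-trans j<1+m (≰⇒> 1+c≰m)
    i<1+c = <-trans i<j j<1+c

∈⇒≤sum : ∀ {n ns} → n ∈ ns → n ≤ sum ns
∈⇒≤sum {ns = n ∷ ns} (here refl) = m≤m+n n (sum ns)
∈⇒≤sum {ns = m ∷ ns} (there n∈ns) = ≤-trans (∈⇒≤sum n∈ns) (m≤n+m (sum ns) m)

module _ {Σ' : Signature} (T : Theory Σ') (cl : Classical) where

  bounded-size : ∀ (M : Structure Σ') ρ c → HasCard c (Dom M) → Models T M ρ → ∀ q {N} →
                 (∀ x → FreeIn x (proj₁ q) → x < N) → Sat M ρ (proj₁ q) →
                 ∀ m → ¬ Satisfiable T (withDistinct q N m) → ∃ λ i → i < m × c ≡ fin (suc i)
  bounded-size M ρ c card ⊨T q {N} q<N sat m unsat with small-or-injective (inhab M) c card m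
  ... | inj₁ small = small
  ... | inj₂ (g , g-injective) =
    ⊥-elim (unsat (M , ρ' , tt , Models-reassign M {T} ⊨T , sat' , Sat-conj⁺ M ρ' (distinct⁺ M ρ' injective)))
    where
    ρ' = ρ ▷[ N ] g
    sat' = Sat-agree M (proj₁ q) (λ x x∈q → sym (▷-below ρ N g (q<N x x∈q))) sat
    injective : Injective≤ (ρ' ∘ (N +_)) m
    injective i<j j<1+m eq = g-injective i<j j<1+m (trans (sym (▷-above ρ N g _)) (trans eq (▷-above ρ N g _)))

  finite-spectrum-bound : ∀ q → FiniteSpec T q → ∃ λ m → ∀ N → ¬ Satisfiable T (withDistinct q N m)
  finite-spectrum-bound q (L , spec⇔ , _) = sum L , unsat
    where
    unsat : ∀ N → ¬ Satisfiable T (withDistinct q N (sum L))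
    unsat N (M , ρ , _ , ⊨T , sat , dist) with löwenheim-skolem cl M ρ
    ... | c , M' , ρ' , card , elem
      with Equivalence.to (spec⇔ c) (M' , ρ' , card , (λ ψ ax → elem ψ (⊨T ψ ax)) , elem (proj₁ q) sat)
    ...   | n , refl , n∈L with pigeonhole (s≤s (∈⇒≤sum n∈L)) (λ i → Inverse.to card (ρ' (N + toℕ i)))
    ...     | i , j , i<j , eq =
      distinct⁻ M' ρ' (Sat-conj⁻ M' ρ' (distinct N (sum L)) (elem (conj (distinct N (sum L))) dist))
                i<j (toℕ<n j) (↔-injective card eq)

-- The combination procedure

uniform-bound : ∀ {A : Set} {P : ℕ → A → Set} → (∀ {k k' x} → k ≤ k' → P k x → P k' x) →
                ∀ {xs} → All (λ x → ∃ λ k → P k x) xs → ∃ λ K → All (P K) xs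
uniform-bound mono [] = 0 , []
uniform-bound mono ((k , p) ∷ ps) with uniform-bound mono ps
... | K , qs = k ⊔ₙ K , mono (m≤m⊔n k K) p ∷ All.map (mono (m≤n⊔m k K)) qs

meets : (𝔉 : Filter) → Classical → ∀ {A B : SubsetN} →
        member 𝔉 A → ¬ member 𝔉 (λ n → ¬ B n) → Σ ℕ λ n → A n × B n
meets 𝔉 cl {A} {B} A∈𝔉 B̅∉𝔉 with cl (Σ ℕ λ n → A n × B n)
... | yes found = found
... | no none = ⊥-elim (B̅∉𝔉 (closed-⊇ 𝔉 A (λ n → ¬ B n) (λ n a b → none (n , a , b)) A∈𝔉))

no-empty-models : ∀ {Σ'} {T : Theory Σ'} {q} → ¬ InSpec T q (fin 0)
no-empty-models (M , _ , card , _) with () ← Inverse.to card (inhab M)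

_≟ᴹ_ : DecidableEquality (Maybe Bool)
_≟ᴹ_ = Maybe.≡-dec Bool._≟_

size : ℕ → ℕ*
size i = suc i , s≤s z≤n

module Combination {Σ₁ Σ₂ : Signature} (T₁ : Theory Σ₁) (T₂ : Theory Σ₂)
  (D₁ : DecidableTheory T₁) (S₁ : ComputableFiniteSpectra T₁)
  (D₂ : DecidableTheory T₂) (S₂ : ComputableFiniteSpectra T₂) where

  -- answers after k steps: does the left (right) part have a model of size i + 1, or
  -- one in which the m + 1 variables above the shared ones are distinct?
  spec₁ spec₂ large₁ large₂ : Candidate Σ₁ Σ₂ → ℕ → ℕ → Maybe Bool
  spec₁ c i = run (proj₁ S₁) (left c , size i)
  spec₂ c i = run (proj₁ S₂) (right c , size i)
  large₁ c m = run (proj₁ D₁) (withDistinct (left c) (width c) m)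
  large₂ c m = run (proj₁ D₂) (withDistinct (right c) (width c) m)

  CommonSize NoCommonSize Small : Candidate Σ₁ Σ₂ → ℕ → ℕ → Set
  CommonSize c k i = spec₁ c i k ≡ just true × spec₂ c i k ≡ just true
  NoCommonSize c k i = spec₁ c i k ≡ just false ⊎ spec₂ c i k ≡ just false
  Small c k m = large₁ c m k ≡ just false ⊎ large₂ c m k ≡ just false

  Accepts Refutes : Candidate Σ₁ Σ₂ → ℕ → Set
  Accepts c k = ∃ λ i → i < k × CommonSize c k i
  Refutes c k = ∃ λ m → m < k × Small c k m × (∀ {i} → i < m → NoCommonSize c k i)

  accepts? : ∀ c k → Dec (Accepts c k)
  accepts? c k = anyUpTo? (λ i → (spec₁ c i k ≟ᴹ just true) ×-dec (spec₂ c i k ≟ᴹ just true)) k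

  refutes? : ∀ c k → Dec (Refutes c k)
  refutes? c k = anyUpTo? (λ m → ((large₁ c m k ≟ᴹ just false) ⊎-dec (large₂ c m k ≟ᴹ just false))
    ×-dec allUpTo? (λ i → (spec₁ c i k ≟ᴹ just false) ⊎-dec (spec₂ c i k ≟ᴹ just false)) m) k

  decision : Algorithm (QF (Σ₁ ⊕ Σ₂))
  decision (φ , _) k with any? (λ c → accepts? c k) (candidates φ) | all? (λ c → refutes? c k) (candidates φ)
  ... | yes _ | _ = just true
  ... | no _ | yes _ = just false
  ... | no _ | no _ = nothing

  decision-true : ∀ φ q k → decision (φ , q) k ≡ just true → Any (λ c → Accepts c k) (candidates φ)
  decision-true φ q k with any? (λ c → accepts? c k) (candidates φ) | all? (λ c → refutes? c k) (candidates φ)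
  ... | yes acc | _ = λ _ → acc
  ... | no _ | yes _ = λ ()
  ... | no _ | no _ = λ ()

  decision-false : ∀ φ q k → decision (φ , q) k ≡ just false → All (λ c → Refutes c k) (candidates φ)
  decision-false φ q k with any? (λ c → accepts? c k) (candidates φ) | all? (λ c → refutes? c k) (candidates φ)
  ... | yes _ | _ = λ ()
  ... | no _ | yes ref = λ _ → ref
  ... | no _ | no _ = λ ()

  decision-halts : ∀ φ q k → All (λ c → Accepts c k ⊎ Refutes c k) (candidates φ) → decision (φ , q) k ≢ nothing
  decision-halts φ q k decided with any? (λ c → accepts? c k) (candidates φ) | all? (λ c → refutes? c k) (candidates φ)
  ... | yes _ | _ = λ ()
  ... | no _ | yes _ = λ ()
  ... | no ¬acc | no ¬ref = λ _ → ¬ref (All.zipWith (λ (a⊎r , ¬a) → [ ⊥-elim ∘ ¬a , id ]′ a⊎r)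
                                                    (decided , All.¬Any⇒All¬ _ ¬acc))

  accepts-mono : ∀ c {k k'} → k ≤ k' → Accepts c k → Accepts c k'
  accepts-mono c k≤k' (i , i<k , t₁ , t₂) = i , <-≤-trans i<k k≤k' , run-mono _ _ k≤k' t₁ , run-mono _ _ k≤k' t₂

  refutes-mono : ∀ c {k k'} → k ≤ k' → Refutes c k → Refutes c k'
  refutes-mono c k≤k' (m , m<k , small , none) =
    m , <-≤-trans m<k k≤k' , ⊎-map (run-mono _ _ k≤k') (run-mono _ _ k≤k') small ,
    ⊎-map (run-mono _ _ k≤k') (run-mono _ _ k≤k') ∘ none

  open Purification {Σ₁} {Σ₂} using (naming)

  module Correctness (cl : Classical) where
    module Dec₁ = Decider (proj₂ D₁ cl)
    module Dec₂ = Decider (proj₂ D₂ cl)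
    module Spec₁ = Decider (proj₂ S₁ cl)
    module Spec₂ = Decider (proj₂ S₂ cl)

    accepted-model : ∀ C k → Any (λ c → Accepts c k) (candidatesFor C) → ModelOf T₁ T₂ cl C
    accepted-model C k accepted with candidatesFor⁻ C accepted
    ... | a , i , _ , t₁ , t₂ = candidate-sound T₁ T₂ cl C a (Spec₁.true⇒P k t₁) (Spec₂.true⇒P k t₂)

    disjunct-model : ∀ φ q {C} → C ∈ dnf φ true → ModelOf T₁ T₂ cl C → Satisfiable (T₁ ⊔ T₂) (φ , q)
    disjunct-model φ q C∈ (M , ρ , ⊨T , holds) = M , ρ , tt , ⊨T , dnf-sound M ρ φ true (lose C∈ holds)

    accepted-satisfiable : ∀ φ q k → Any (λ c → Accepts c k) (candidates φ) → Satisfiable (T₁ ⊔ T₂) (φ , q)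
    accepted-satisfiable φ q k accepted with find (Any.concatMap⁻ candidatesFor accepted)
    ... | C , C∈ , accepted' = disjunct-model φ q C∈ (accepted-model C k accepted')

    not-refuted : ∀ {c k} M ρ₀ card → HasCard card (Dom M) → Models (T₁ ⊔ T₂) M (naming cl M ρ₀) →
                  SatisfiedBy cl M ρ₀ c → ¬ Refutes c k
    not-refuted {c} {k} M ρ₀ card hasCard ⊨T (sat₁ , sat₂) = refutation
      where
      ρ* = naming cl M ρ₀
      ⊨T₁ = Models-reduct₁ T₁ T₂ M ⊨T
      ⊨T₂ = Models-reduct₂ T₁ T₂ M ⊨T
      size-not-excluded : ∀ {i} → card ≡ fin (suc i) → ¬ NoCommonSize c k i
      size-not-excluded refl (inj₁ no₁) = Spec₁.false⇒¬P k no₁ (reduct₁ M , ρ* , hasCard , ⊨T₁ , sat₁)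
      size-not-excluded refl (inj₂ no₂) = Spec₂.false⇒¬P k no₂ (reduct₂ M , ρ* , hasCard , ⊨T₂ , sat₂)
      refutation : ¬ Refutes c k
      refutation (m , _ , inj₁ small₁ , none)
        with bounded-size T₁ cl (reduct₁ M) ρ* card hasCard ⊨T₁ (left c) (left-bounded c) sat₁ m
                          (Dec₁.false⇒¬P k small₁)
      ... | i , i<m , card≡ = size-not-excluded card≡ (none i<m)
      refutation (m , _ , inj₂ small₂ , none)
        with bounded-size T₂ cl (reduct₂ M) ρ* card hasCard ⊨T₂ (right c) (right-bounded c) sat₂ m
                          (Dec₂.false⇒¬P k small₂)
      ... | i , i<m , card≡ = size-not-excluded card≡ (none i<m)

    refuted-unsatisfiable : ∀ φ q k → All (λ c → Refutes c k) (candidates φ) → ¬ Satisfiable (T₁ ⊔ T₂) (φ , q)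
    refuted-unsatisfiable φ q k refuted (M , ρ , _ , ⊨T , sat) with löwenheim-skolem cl M ρ
    ... | card , M' , ρ' , hasCard , elementary
      with find (candidates-complete cl M' ρ' φ q (elementary φ sat))
    ...   | c , c∈ , satisfied =
      not-refuted {c} {k} M' ρ' card hasCard (Models-reassign M' {T₁ ⊔ T₂} (λ ψ ax → elementary ψ (⊨T ψ ax))) satisfied
                  (All.lookup refuted c∈)

  module Halting (𝔉 : Filter) (cl : Classical)
    (gentle₁ : ∀ q → FiniteSpec T₁ q ⊎ (InSpec T₁ q ℵ₀ × member 𝔉 (FinPart T₁ q)))
    (gentle₂ : ∀ q → FiniteSpec T₂ q ⊎ (InSpec T₂ q ℵ₀ × ¬ member 𝔉 (λ n → ¬ FinPart T₂ q n))) where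
    open Correctness cl

    Answered : Candidate Σ₁ Σ₂ → ℕ → ℕ → Set
    Answered c k i = (∃ λ b → spec₁ c i k ≡ just b) × (∃ λ b → spec₂ c i k ≡ just b)

    answered-mono : ∀ c {k k' i} → k ≤ k' → Answered c k i → Answered c k' i
    answered-mono c k≤k' ((b₁ , e₁) , (b₂ , e₂)) = (b₁ , run-mono _ _ k≤k' e₁) , (b₂ , run-mono _ _ k≤k' e₂)

    answered-eventually : ∀ c i → ∃ λ k → Answered c k i
    answered-eventually c i with Spec₁.halts (left c , size i) | Spec₂.halts (right c , size i)
    ... | k₁ , b₁ , e₁ | k₂ , b₂ , e₂ =
      k₁ ⊔ₙ k₂ , (b₁ , run-mono _ _ (m≤m⊔n k₁ k₂) e₁) , (b₂ , run-mono _ _ (m≤n⊔m k₁ k₂) e₂)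

    answered-below : ∀ c m → ∃ λ k → ∀ {i} → i < m → Answered c k i
    answered-below c m
      with uniform-bound {P = Answered c} (answered-mono c) (All.applyUpTo⁺₁ id m λ {i} _ → answered-eventually c i)
    ... | k , answered = k , All.applyUpTo⁻ id m answered

    no-common-size : ∀ c {k i} → Answered c k i → ¬ CommonSize c k i → NoCommonSize c k i
    no-common-size c ((false , e₁) , _) _ = inj₁ e₁
    no-common-size c ((true , _) , (false , e₂)) _ = inj₂ e₂
    no-common-size c ((true , e₁) , (true , e₂)) ¬common = ⊥-elim (¬common (e₁ , e₂))

    -- Once all models of one side are known to have fewer than m + 1 elements, waiting
    -- for the spectrum answers below m settles the candidate.
    settled-by-bound : ∀ c {m k₀} → Small c k₀ m → ∃ λ k → Accepts c k ⊎ Refutes c k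
    settled-by-bound c {m} {k₀} small = k , settled
      where
      k₁ = proj₁ (answered-below c m)
      k = suc (k₁ ⊔ₙ k₀ ⊔ₙ m)
      k₁≤k : k₁ ≤ k
      k₁≤k = m≤n⇒m≤1+n (m≤n⇒m≤n⊔o m (m≤m⊔n k₁ k₀))
      k₀≤k : k₀ ≤ k
      k₀≤k = m≤n⇒m≤1+n (m≤n⇒m≤n⊔o m (m≤n⊔m k₁ k₀))
      m<k : m < k
      m<k = s≤s (m≤n⊔m (k₁ ⊔ₙ k₀) m)
      settled : Accepts c k ⊎ Refutes c k
      settled with accepts? c k
      ... | yes accepted = inj₁ accepted
      ... | no ¬accepted = inj₂ (m , m<k , ⊎-map (run-mono _ _ k₀≤k) (run-mono _ _ k₀≤k) small ,
        λ {i} i<m → no-common-size c {k} {i} (answered-mono c {k' = k} {i} k₁≤k (proj₂ (answered-below c m) i<m))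
                                         (λ common → ¬accepted (i , <-trans i<m m<k , common)))

    accepted-eventually : ∀ c {i} → InSpec T₁ (left c) (fin (suc i)) → InSpec T₂ (right c) (fin (suc i)) →
                          ∃ λ k → Accepts c k
    accepted-eventually c {i} in₁ in₂
      with Spec₁.P⇒true {left c , size i} in₁ | Spec₂.P⇒true {right c , size i} in₂
    ... | k₁ , e₁ | k₂ , e₂ = k , i , i<k , run-mono _ _ k₁≤k e₁ , run-mono _ _ k₂≤k e₂
      where
      k = suc (i ⊔ₙ k₁ ⊔ₙ k₂)
      i<k : i < k
      i<k = s≤s (m≤n⇒m≤n⊔o k₂ (m≤m⊔n i k₁))
      k₁≤k : k₁ ≤ k
      k₁≤k = m≤n⇒m≤1+n (m≤n⇒m≤n⊔o k₂ (m≤n⊔m i k₁))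
      k₂≤k : k₂ ≤ k
      k₂≤k = m≤n⇒m≤1+n (m≤n⊔m (i ⊔ₙ k₁) k₂)

    eventually-settled : ∀ c → ∃ λ k → Accepts c k ⊎ Refutes c k
    eventually-settled c with gentle₁ (left c) | gentle₂ (right c)
    ... | inj₁ finite₁ | _ with finite-spectrum-bound T₁ cl (left c) finite₁
    ...   | m , unsat with Dec₁.¬P⇒false (unsat (width c))
    ...     | k₀ , small = settled-by-bound c {m} {k₀} (inj₁ small)
    eventually-settled c | inj₂ _ | inj₁ finite₂ with finite-spectrum-bound T₂ cl (right c) finite₂
    ...   | m , unsat with Dec₂.¬P⇒false (unsat (width c))
    ...     | k₀ , small = settled-by-bound c {m} {k₀} (inj₂ small)
    eventually-settled c | inj₂ (_ , in𝔉) | inj₂ (_ , co-in𝔉)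
      with meets 𝔉 cl {FinPart T₁ (left c)} {FinPart T₂ (right c)} in𝔉 co-in𝔉
    ... | zero , empty , _ = ⊥-elim (no-empty-models {T = T₁} {left c} empty)
    ... | suc i , in₁ , in₂ with accepted-eventually c in₁ in₂
    ...   | k , accepted = k , inj₁ accepted

    decides : Decides decision (Satisfiable (T₁ ⊔ T₂))
    decides (φ , q) = halts , correct
      where
      halts : ∃ λ k → decision (φ , q) k ≢ nothing
      halts with uniform-bound {P = λ k c → Accepts c k ⊎ Refutes c k}
                   (λ {_} {_} {c} k≤k' → ⊎-map (accepts-mono c k≤k') (refutes-mono c k≤k'))
                   (All.tabulate {xs = candidates φ} λ {c} _ → eventually-settled c)
      ... | k , settled = k , decision-halts φ q k settled
      correct : ∀ k b → decision (φ , q) k ≡ just b → (b ≡ true ⇔ Satisfiable (T₁ ⊔ T₂) (φ , q))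
      correct k true eq = mk⇔ (λ _ → accepted-satisfiable φ q k (decision-true φ q k eq)) (λ _ → refl)
      correct k false eq = mk⇔ (λ ()) (⊥-elim ∘ refuted-unsatisfiable φ q k (decision-false φ q k eq))

theorem5p19 : (𝔉 : Filter) → IsFree 𝔉 →
              {Σ₁ Σ₂ : Signature} (T₁ : Theory Σ₁) (T₂ : Theory Σ₂) →
              QuasiGentle 𝔉 T₁ → CoQuasiGentle 𝔉 T₂ →
              DecidableTheory (T₁ ⊔ T₂)
theorem5p19 𝔉 _ T₁ T₂ (D₁ , S₁ , gentle₁) (D₂ , S₂ , gentle₂) =
  decision , λ cl → Halting.decides 𝔉 cl (gentle₁ cl) (gentle₂ cl)
  where open Combination T₁ T₂ D₁ S₁ D₂ S₂
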